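{- Let $G$ be a cobweb with presentation $(C,I)$ and let $\omega$ be a wedge-selection for $(G,C,I)$. Then for all $u, v, w \in I$ the following hold. (a) The graph $\omega(u) \cap \omega(v)$ has at most two components. (b) The graph $\omega(u) \cap \omega(v)$ has exactly two components if and only if $u$ attaches to $\omega(v)$ and $v$ attaches to $\omega(u)$. (c) If $\omega(u) \cap \omega(v)$ has exactly two components and $w$ attaches to both $\omega(u)$ and $\omega(v)$, then: if $w$ has a neighbour in each component of $\omega(u)\cap\omega(v)$, then $\omega(w)$ improves at least one of $\omega(u)$ and $\omega(v)$; and if $w$ has neighbours in only one component of $\omega(u)\cap\omega(v)$, then $\omega(w)$ either improves both $\omega(u)$ and $\omega(v)$ or improves neither of them.
   Context: All graphs are finite and simple. For graphs $G,H$, $G\cap H$ is the graph with vertex set $V(G)\cap V(H)$ and edge set $E(G)\cap E(H)$. A graph $G$ is a cobweb with presentation $(C,I)$ if: $C$ is an induced cycle of $G$ and $I := V(G)\setminus V(C)$ is a non-empty independent set; $G$ has minimum degree at least $2$; and $N(u)\not\subseteq N(v)$ for all distinct $u,v\in I$. A wedge of $(G,C,I)$ is a (not necessarily induced) cycle $W$ in $G$ containing exactly one vertex $v$ of $I$ (its anchor) and exactly two vertices of $N(v)$; so $W-v$ is a subpath of $C$ whose endpoints are the two neighbours of $v$ in $W$. A vertex $u\in I\setminus V(W)$ attaches to $W$ if $N(u)\subseteq V(W)$. A wedge-selection for $(G,C,I)$ is a map $\omega$ assigning to each $v\in I$ a wedge $\omega(v)$ anchored in $v$. For $u,v\in I$,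 $\omega(u)$ improves $\omega(v)$ if $\omega(u)-u$ is a proper subgraph of $\omega(v)-v$. -}

module Defs where

open import Data.Nat using (ℕ; _≤_)
open import Data.Fin using (Fin)
open import Data.Bool using (Bool; true; false)
open import Data.List using (List; []; _∷_; _++_; [_]; length)
open import Data.List.Membership.Propositional using (_∈_; _∉_)
open import Data.List.Relation.Unary.Unique.Propositional using (Unique)
open import Data.Product using (Σ; ∃; ∃-syntax; _×_; _,_)
open import Data.Sum using (_⊎_)
open import Data.Empty using (⊥)
open import Relation.Nullary using (¬_)
open import Relation.Binary.PropositionalEquality using (_≡_; _≢_)

record Graph : Set where
  field
    n      : ℕ
    adj    : Fin n → Fin n → Bool
    sym    : ∀ x y → adj x y ≡ adj y x
    irrefl : ∀ x → adj x x ≡ false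

module _ (G : Graph) where
  open Graph G

  Vtx : Set
  Vtx = Fin n

  E : Vtx → Vtx → Set
  E x y = adj x y ≡ true

record Sub (n : ℕ) : Set₁ where
  field
    V  : Fin n → Set
    Ed : Fin n → Fin n → Set
open Sub public

_∩_ : ∀ {n} → Sub n → Sub n → Sub n
H ∩ K = record { V = λ x → V H x × V K x ; Ed = λ a b → Ed H a b × Ed K a b }

_─_ : ∀ {n} → Sub n → Fin n → Sub n
H ─ v = record { V = λ x → V H x × x ≢ v
               ; Ed = λ a b → Ed H a b × a ≢ v × b ≢ v }

_⊆G_ : ∀ {n} → Sub n → Sub n → Set
H ⊆G K = (∀ x → V H x → V K x) × (∀ a b → Ed H a b → Ed K a b)

-- proper subgraph: subgraph and not equal (i.e. not conversely a subgraph)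
_⊂G_ : ∀ {n} → Sub n → Sub n → Set
H ⊂G K = H ⊆G K × ¬ (K ⊆G H)

data Conn {n : ℕ} (H : Sub n) : Fin n → Fin n → Set where
  here : ∀ {x} → V H x → Conn H x x
  step : ∀ {x y z} → V H x → Ed H x y → Conn H y z → Conn H x z

-- H has at most two components: among any three vertices, two lie in
-- the same component.
AtMostTwoComponents : ∀ {n} → Sub n → Set
AtMostTwoComponents H =
  ∀ x y z → V H x → V H y → V H z → Conn H x y ⊎ Conn H x z ⊎ Conn H y z

ExactlyTwoComponents : ∀ {n} → Sub n → Set
ExactlyTwoComponents H =
  AtMostTwoComponents H × (∃[ x ] ∃[ y ] (V H x × V H y × ¬ Conn H x y))

data Consec {A : Set} : List A → A → A → Set where
  here  : ∀ {x y xs} → Consec (x ∷ y ∷ xs) x y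
  there : ∀ {x xs a b} → Consec xs a b → Consec (x ∷ xs) a b

-- directed cycle edges of the cyclic sequence x₀ … x_{k-1} (including x_{k-1} x₀)
CycArc : {A : Set} → List A → A → A → Set
CycArc []       a b = ⊥
CycArc (x ∷ xs) a b = Consec ((x ∷ xs) ++ [ x ]) a b

CycEdge : {A : Set} → List A → A → A → Set
CycEdge xs a b = CycArc xs a b ⊎ CycArc xs b a

module _ (G : Graph) where
  open Graph G

  -- a cycle in G (not necessarily induced)
  record Cycle : Set where
    field
      verts  : List (Fin n)
      unique : Unique verts
      long   : 3 ≤ length verts
      edges  : ∀ a b → CycArc verts a b → E G a b
  open Cycle public

  cyc : Cycle → Sub n
  cyc W = record { V = λ x → x ∈ verts W ; Ed = CycEdge (verts W) }

  Induced : Cycle → Set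
  Induced C = ∀ a b → a ∈ verts C → b ∈ verts C → E G a b → CycEdge (verts C) a b

  -- cobweb with presentation (C , I), where I = V(G) ∖ V(C)
  record IsCobweb (C : Cycle) : Set where
    field
      induced     : Induced C
      I-nonempty  : ∃[ x ] (x ∉ verts C)
      I-indep     : ∀ x y → x ∉ verts C → y ∉ verts C → ¬ E G x y
      minDeg2     : ∀ x → ∃[ a ] ∃[ b ] (a ≢ b × E G x a × E G x b)
      nonNested   : ∀ u v → u ∉ verts C → v ∉ verts C → u ≢ v →
                    ¬ (∀ x → E G u x → E G v x)

  module _ (C : Cycle) where
    InI : Fin n → Set
    InI x = x ∉ verts C

    record Wedge (v : Fin n) : Set where
      field
        cycle     : Cycle
        anchorIn  : v ∈ verts cycle
        onlyAnchor : ∀ x → x ∈ verts cycle → InI x → x ≡ v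
        nbrA nbrB : Fin n
        nbrA≢nbrB : nbrA ≢ nbrB
        nbrA-adj  : E G v nbrA
        nbrB-adj  : E G v nbrB
        nbrA-in   : nbrA ∈ verts cycle
        nbrB-in   : nbrB ∈ verts cycle
        onlyTwo   : ∀ x → E G v x → x ∈ verts cycle → x ≡ nbrA ⊎ x ≡ nbrB
    open Wedge public

    wsub : ∀ {v} → Wedge v → Sub n
    wsub W = cyc (cycle W)

    Attaches : ∀ {v} → Fin n → Wedge v → Set
    Attaches u W = InI u × u ∉ verts (cycle W) × (∀ x → E G u x → x ∈ verts (cycle W))

    WedgeSelection : Set
    WedgeSelection = (v : Fin n) → InI v → Wedge v

    Improves : ∀ {u v} → Wedge u → Wedge v → Set
    Improves {u} {v} Wu Wv = (wsub Wu ─ u) ⊂G (wsub Wv ─ v)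

    NbrInEachComponent : Fin n → Sub n → Set
    NbrInEachComponent w H =
      ∃[ a ] ∃[ b ] (E G w a × E G w b × V H a × V H b × ¬ Conn H a b)

    NbrsInOnlyOneComponent : Fin n → Sub n → Set
    NbrsInOnlyOneComponent w H =
      (∃[ a ] (E G w a × V H a)) ×
      (∀ a b → E G w a → E G w b → V H a → V H b → Conn H a b)

{-# OPTIONS --safe #-}
-- Every wedge ω(v) is v together with an arc of C. Numbering C from the start of the arc of
-- ω(u), ω(u) − u is the interval [0, mu] and ω(v) − v is an arc starting at dv. If that arc
-- does not pass through 0, the two arcs meet in an interval and ω(u) ∩ ω(v) is connected.
-- Otherwise the intersection is a tail [0, g] together with a head [dv, mu], and ω(v) has no
-- vertex strictly between g and dv, so it has at most two components and has two exactly when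
-- the head is non-empty; that happens iff u and v attach to each other's wedges. For (c) the ends
-- of the arc of ω(w) are neighbours of w, hence lie in the head or the tail, and comparing
-- arcs decides which wedges ω(w) improves. Inclusions of arcs are proper because two attached
-- wedges with distinct anchors cannot have the same arc: that would give N(u) ⊆ N(v).
module Submission where

open import Defs
open import Data.Nat using (ℕ; zero; suc; _+_; _∸_; _≤_; _<_; z≤n; s≤s; _<?_; _≤?_)
open import Data.Nat.Properties
open import Data.Nat.GeneralisedArithmetic using (iterate)
open import Data.Fin using (Fin) renaming (_≟_ to _≟F_)
open import Data.Product as Product using (∃-syntax; _×_; _,_; proj₁; proj₂)
open import Data.Sum as Sum using (_⊎_; inj₁; inj₂)
open import Data.Empty using (⊥-elim)
open import Data.List using (List; []; _∷_; _++_; [_]; length)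
open import Data.List.Membership.Propositional using (_∈_)
open import Data.List.Relation.Unary.Any using (here; there)
open import Data.List.Relation.Unary.All as All using ()
open import Data.List.Relation.Unary.AllPairs using (_∷_)
open import Data.List.Relation.Unary.Unique.Propositional using (Unique)
open import Function.Base using (_∘′_)
open import Function.Bundles using (_⇔_; mk⇔)
open import Relation.Nullary using (¬_; yes; no)
open import Relation.Binary.Definitions using (DecidableEquality; tri<; tri≈; tri>)
open import Relation.Binary.PropositionalEquality hiding ([_])

module _ {n : ℕ} {H : Sub n} where
  Conn-source : ∀ {x y} → Conn H x y → V H x
  Conn-source (here p)     = p
  Conn-source (step p _ _) = p

  Conn-trans : ∀ {x y z} → Conn H x y → Conn H y z → Conn H x z
  Conn-trans (here _)     c′ = c′
  Conn-trans (step p e c) c′ = step p e (Conn-trans c c′)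

  Conn-sym : (∀ a b → Ed H a b → Ed H b a) → ∀ {x y} → Conn H x y → Conn H y x
  Conn-sym sym-Ed (here p)     = here p
  Conn-sym sym-Ed (step p e c) =
    Conn-trans (Conn-sym sym-Ed c) (step (Conn-source c) (sym-Ed _ _ e) (here p))

  Conn-preserves : (Q : Fin n → Set) → (∀ a b → Ed H a b → Q a → Q b) →
                   ∀ {x y} → Conn H x y → Q x → Q y
  Conn-preserves Q closed (here _)     qx = qx
  Conn-preserves Q closed (step _ e c) qx = Conn-preserves Q closed c (closed _ _ e qx)

  Conn-along : (f : ℕ → Fin n) → ∀ {a b} → a ≤ b →
               (∀ t → a ≤ t → t ≤ b → V H (f t)) →
               (∀ t → a ≤ t → t < b → Ed H (f t) (f (suc t))) → Conn H (f a) (f b)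
  Conn-along f {b = zero} z≤n vs es = here (vs 0 z≤n z≤n)
  Conn-along f {a} {suc b} a≤1+b vs es with m≤n⇒m<n∨m≡n a≤1+b
  ... | inj₂ refl = here (vs a ≤-refl ≤-refl)
  ... | inj₁ (s≤s a≤b) =
    Conn-trans (Conn-along f a≤b (λ t p q → vs t p (m≤n⇒m≤1+n q)) (λ t p q → es t p (m<n⇒m<1+n q)))
               (step (vs b a≤b (n≤1+n b)) (es b a≤b ≤-refl) (here (vs (suc b) a≤1+b ≤-refl)))

Conn-mono : ∀ {n} {H K : Sub n} → H ⊆G K → ∀ {x y} → Conn H x y → Conn K x y
Conn-mono H⊆K (here p)     = here (proj₁ H⊆K _ p)
Conn-mono H⊆K (step p e c) = step (proj₁ H⊆K _ p) (proj₂ H⊆K _ _ e) (Conn-mono H⊆K c)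

module _ {n : ℕ} {H K : Sub n} (H⊆K : H ⊆G K) (K⊆H : K ⊆G H) where
  AtMostTwoComponents-resp : AtMostTwoComponents H → AtMostTwoComponents K
  AtMostTwoComponents-resp two x y z vx vy vz
    with two x y z (proj₁ K⊆H x vx) (proj₁ K⊆H y vy) (proj₁ K⊆H z vz)
  ... | inj₁ c        = inj₁ (Conn-mono H⊆K c)
  ... | inj₂ (inj₁ c) = inj₂ (inj₁ (Conn-mono H⊆K c))
  ... | inj₂ (inj₂ c) = inj₂ (inj₂ (Conn-mono H⊆K c))

  ExactlyTwoComponents-resp : ExactlyTwoComponents H → ExactlyTwoComponents K
  ExactlyTwoComponents-resp (two , x , y , vx , vy , ¬c) =
    AtMostTwoComponents-resp two , x , y , proj₁ H⊆K x vx , proj₁ H⊆K y vy ,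
    λ c → ¬c (Conn-mono K⊆H c)

∩-comm-⊆G : ∀ {n} (H K : Sub n) → (H ∩ K) ⊆G (K ∩ H)
∩-comm-⊆G H K = (λ _ (p , q) → q , p) , (λ _ _ (e , f) → f , e)

ExactlyTwoComponents-∩-comm : ∀ {n} (H K : Sub n) →
  ExactlyTwoComponents (H ∩ K) → ExactlyTwoComponents (K ∩ H)
ExactlyTwoComponents-∩-comm H K =
  ExactlyTwoComponents-resp (∩-comm-⊆G H K) (∩-comm-⊆G K H)

data At {A : Set} : List A → ℕ → A → Set where
  at0 : ∀ {x xs} → At (x ∷ xs) 0 x
  atS : ∀ {x y xs i} → At xs i y → At (x ∷ xs) (suc i) y

module _ {A : Set} where
  ∈⇒At : ∀ {x : A} {xs} → x ∈ xs → ∃[ i ] At xs i x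
  ∈⇒At (here refl) = 0 , at0
  ∈⇒At (there p)   = let i , q = ∈⇒At p in suc i , atS q

  At⇒∈ : ∀ {x : A} {xs i} → At xs i x → x ∈ xs
  At⇒∈ at0     = here refl
  At⇒∈ (atS p) = there (At⇒∈ p)

  At-functional : ∀ {x y : A} {xs i} → At xs i x → At xs i y → x ≡ y
  At-functional at0     at0     = refl
  At-functional (atS p) (atS q) = At-functional p q

  At-injective : ∀ {x : A} {xs i j} → Unique xs → At xs i x → At xs j x → i ≡ j
  At-injective _       at0     at0     = refl
  At-injective (x∉ ∷ _) at0     (atS q) = ⊥-elim (All.lookup x∉ (At⇒∈ q) refl)
  At-injective (x∉ ∷ _) (atS p) at0     = ⊥-elim (All.lookup x∉ (At⇒∈ p) refl)
  At-injective (_ ∷ u)  (atS p) (atS q) = cong suc (At-injective u p q)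

  At-<-length : ∀ {x : A} {xs i} → At xs i x → i < length xs
  At-<-length at0     = s≤s z≤n
  At-<-length (atS p) = s≤s (At-<-length p)

  At-++⁻ : ∀ {x : A} xs {ys i} → At (xs ++ ys) i x →
           At xs i x ⊎ ∃[ j ] (i ≡ length xs + j × At ys j x)
  At-++⁻ []       p       = inj₂ (_ , refl , p)
  At-++⁻ (a ∷ xs) at0     = inj₁ at0
  At-++⁻ (a ∷ xs) (atS p) with At-++⁻ xs p
  ... | inj₁ q             = inj₁ (atS q)
  ... | inj₂ (j , refl , q) = inj₂ (j , refl , q)

  Consec⇒At : ∀ {xs} {a b : A} → Consec xs a b → ∃[ i ] (At xs i a × At xs (suc i) b)
  Consec⇒At here      = 0 , at0 , atS at0
  Consec⇒At (there c) = let i , p , q = Consec⇒At c in suc i , atS p , atS q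

  Consec-++-[]-∈ : ∀ {l : List A} {f a b} → Consec (l ++ [ f ]) a b → a ∈ l
  Consec-++-[]-∈ {[]}          (there ())
  Consec-++-[]-∈ {c ∷ []}      here              = here refl
  Consec-++-[]-∈ {c ∷ []}      (there (there ()))
  Consec-++-[]-∈ {c ∷ d ∷ l}   here              = here refl
  Consec-++-[]-∈ {c ∷ d ∷ l}   (there p)         = there (Consec-++-[]-∈ {d ∷ l} p)

module _ {X : Set} {L R : X → Set} where
  SameSide : X → X → Set
  SameSide a b = (L a × L b) ⊎ (R a × R b)

  two-of-three-same-side : ∀ {a b c} → L a ⊎ R a → L b ⊎ R b → L c ⊎ R c →
                           SameSide a b ⊎ SameSide a c ⊎ SameSide b c
  two-of-three-same-side (inj₁ la) (inj₁ lb) _         = inj₁ (inj₁ (la , lb))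
  two-of-three-same-side (inj₂ ra) (inj₂ rb) _         = inj₁ (inj₂ (ra , rb))
  two-of-three-same-side (inj₁ la) (inj₂ _)  (inj₁ lc) = inj₂ (inj₁ (inj₁ (la , lc)))
  two-of-three-same-side (inj₁ _)  (inj₂ rb) (inj₂ rc) = inj₂ (inj₂ (inj₂ (rb , rc)))
  two-of-three-same-side (inj₂ _)  (inj₁ lb) (inj₁ lc) = inj₂ (inj₂ (inj₁ (lb , lc)))
  two-of-three-same-side (inj₂ ra) (inj₁ _)  (inj₂ rc) = inj₂ (inj₁ (inj₂ (ra , rc)))

iterate-+ : ∀ {A : Set} (f : A → A) x a b → iterate f x (a + b) ≡ iterate f (iterate f x a) b
iterate-+ f x zero    b = refl
iterate-+ f x (suc a) b = iterate-+ f (f x) a b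

iterate-suc : ∀ {A : Set} (f : A → A) x j → iterate f x (suc j) ≡ f (iterate f x j)
iterate-suc f x zero    = refl
iterate-suc f x (suc j) = iterate-suc f (f x) j

module CyclicSuccessor {A : Set} (_≟_ : DecidableEquality A) where
  nextFrom : A → A → List A → A → A
  nextFrom f a []      x = f
  nextFrom f a (b ∷ r) x with x ≟ a
  ... | yes _ = b
  ... | no  _ = nextFrom f b r x

  -- The successor of x on the cyclic list l; off l it is junk.
  next : List A → A → A
  next []      x = x
  next (h ∷ t)   = nextFrom h h t

  nextFrom-Consec : ∀ f a r {x} → x ∈ a ∷ r → Consec (a ∷ r ++ [ f ]) x (nextFrom f a r x)
  nextFrom-Consec f a []      (here refl) = here
  nextFrom-Consec f a (b ∷ r) {x} x∈ with x ≟ a | x∈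
  ... | yes refl | _        = here
  ... | no x≢a   | here x≡a = ⊥-elim (x≢a x≡a)
  ... | no _     | there x∈r = there (nextFrom-Consec f b r x∈r)

  Consec⇒≡nextFrom : ∀ f a r {x c} → Unique (a ∷ r) →
                     Consec (a ∷ r ++ [ f ]) x c → c ≡ nextFrom f a r x
  Consec⇒≡nextFrom f a []      _ here              = refl
  Consec⇒≡nextFrom f a []      _ (there (there ()))
  Consec⇒≡nextFrom f a (b ∷ r) {x} (a∉ ∷ u) c with x ≟ a | c
  ... | yes _    | here    = refl
  ... | yes refl | there c′ = ⊥-elim (All.lookup a∉ (Consec-++-[]-∈ {l = b ∷ r} c′) refl)
  ... | no x≢a   | here    = ⊥-elim (x≢a refl)
  ... | no _     | there c′ = Consec⇒≡nextFrom f b r u c′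

  module NonEmpty (h : A) (t : List A) (U : Unique (h ∷ t)) where
    private
      l : List A
      l = h ∷ t
      L : ℕ
      L = length l
      σ : A → A
      σ = next l

    CycArc⇒next : ∀ {a b} → CycArc l a b → a ∈ l × b ≡ σ a
    CycArc⇒next c = Consec-++-[]-∈ {l = l} c , Consec⇒≡nextFrom h h t U c

    next-CycArc : ∀ {a} → a ∈ l → CycArc l a (σ a)
    next-CycArc = nextFrom-Consec h h t

    private
      At-[h] : ∀ {j y} → At (h ∷ []) j y → j ≡ 0 × y ≡ h
      At-[h] at0 = refl , refl

      At-next : ∀ {i x} → At l i x → At (l ++ [ h ]) (suc i) (σ x)
      At-next {i} p with Consec⇒At (next-CycArc (At⇒∈ p))
      ... | j , q₁ , q₂ with At-++⁻ l q₁
      ... | inj₁ q with At-injective U p q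
      ... | refl = q₂
      At-next p | j , q₁ , q₂ | inj₂ (j′ , refl , q′) with At-[h] q′
      ... | refl , _ with At-++⁻ l q₂
      ... | inj₁ r = ⊥-elim (<-irrefl refl (≤-trans (s≤s (m≤m+n L 0)) (<⇒≤ (At-<-length r))))
      ... | inj₂ (j″ , e , r) with At-[h] r
      ... | refl , _ = ⊥-elim (1+n≢n e)

      At-next-inside : ∀ {i x} → At l i x → suc i < L → At l (suc i) (σ x)
      At-next-inside p lt with At-++⁻ l (At-next p)
      ... | inj₁ q = q
      ... | inj₂ (j , e , _) =
        ⊥-elim (<-irrefl refl (≤-trans lt (≤-trans (m≤m+n L j) (≤-reflexive (sym e)))))

      At-next-last : ∀ {i x} → At l i x → suc i ≡ L → σ x ≡ h
      At-next-last p e with At-++⁻ l (At-next p)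
      ... | inj₁ q           = ⊥-elim (<-irrefl e (At-<-length q))
      ... | inj₂ (_ , _ , r) = proj₂ (At-[h] r)

      At-iterate : ∀ s {i x} → At l i x → i + s < L → At l (i + s) (iterate σ x s)
      At-iterate zero    {i} p _  = subst (λ j → At l j _) (sym (+-identityʳ i)) p
      At-iterate (suc s) {i} {x} p lt =
        subst (λ j → At l j (iterate σ (σ x) s)) (sym (+-suc i s))
          (At-iterate s (At-next-inside p (≤-trans (s≤s (s≤s (m≤m+n i s))) i+1+s<L)) i+1+s<L)
        where
          i+1+s<L : suc (i + s) < L
          i+1+s<L = subst (_< L) (+-suc i s) lt

      steps-to-head : ∀ {i x} → At l i x → ∃[ r ] (suc (i + r) ≡ L × iterate σ x (suc r) ≡ h)
      steps-to-head {i} {x} p = r , e , trans (iterate-suc σ x r) (At-next-last (At-iterate r p (≤-reflexive e)) e)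
        where
          r : ℕ
          r = L ∸ suc i
          e : suc (i + r) ≡ L
          e = m+[n∸m]≡n (At-<-length p)

      iterate-from-h : ∀ {i x} → At l i x → ∀ {r} → iterate σ x (suc r) ≡ h →
                       ∀ q → iterate σ h q ≡ iterate σ x (suc r + q)
      iterate-from-h p {r} w q = trans (cong (λ y → iterate σ y q) (sym w)) (sym (iterate-+ σ _ (suc r) q))

    next-∈ : ∀ {a} → a ∈ l → σ a ∈ l
    next-∈ a∈ with ∈⇒At a∈
    ... | i , p with suc i <? L
    ... | yes lt = At⇒∈ (At-next-inside p lt)
    ... | no nlt = subst (_∈ l) (sym (At-next-last p (≤-antisym (At-<-length p) (≮⇒≥ nlt)))) (here refl)

    next^-∈ : ∀ s {x} → x ∈ l → iterate σ x s ∈ l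
    next^-∈ zero    x∈ = x∈
    next^-∈ (suc s) x∈ = next^-∈ s (next-∈ x∈)

    next^-length : ∀ {x} → x ∈ l → iterate σ x L ≡ x
    next^-length {x} x∈ with ∈⇒At x∈
    ... | i , p with steps-to-head p
    ... | r , e , w = sym (At-functional p (subst (At l i) σⁱh≡σᴸx (At-iterate i at0 (At-<-length p))))
      where
        σⁱh≡σᴸx : iterate σ h i ≡ iterate σ x L
        σⁱh≡σᴸx = trans (iterate-from-h p {r} w i) (cong (iterate σ _) (trans (cong suc (+-comm r i)) e))

    next^-reach : ∀ {x y} → x ∈ l → y ∈ l → ∃[ s ] (s < L × y ≡ iterate σ x s)
    next^-reach x∈ y∈ with ∈⇒At x∈ | ∈⇒At y∈
    ... | i , p | j , q with i ≤? j
    ... | yes i≤j = j ∸ i , ≤-trans (s≤s (m∸n≤m j i)) (At-<-length q) ,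
          At-functional q (subst (λ z → At l z (iterate σ _ (j ∸ i))) (m+[n∸m]≡n i≤j)
            (At-iterate (j ∸ i) p (subst (_< L) (sym (m+[n∸m]≡n i≤j)) (At-<-length q))))
    ... | no j<i with steps-to-head p
    ... | r , e , w = suc r + j , subst (suc r + j <_) (trans (cong suc (+-comm r i)) e) (+-monoʳ-< (suc r) (≰⇒> j<i)) ,
          At-functional q (subst (At l j) (iterate-from-h p {r} w j) (At-iterate j at0 (At-<-length q)))

    next^-≢ : ∀ s {x} → x ∈ l → 0 < s → s < L → iterate σ x s ≢ x
    next^-≢ s {x} x∈ 0<s s<L σˢx≡x with ∈⇒At x∈
    ... | i , p with i + s <? L
    ... | yes lt = <-irrefl (sym (+-cancelˡ-≡ i s 0 (trans (At-injective U (subst (At l _) σˢx≡x (At-iterate s p lt)) p) (sym (+-identityʳ i))))) 0<s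
    ... | no nlt with steps-to-head p
    ... | r , e , w = <-irrefl (sym (+-cancelˡ-≡ i L s (trans (cong (_+ L) (sym i′≡i)) q+L≡i+s))) s<L
      where
        q : ℕ
        q = i + s ∸ L
        q+L≡i+s : q + L ≡ i + s
        q+L≡i+s = m∸n+n≡m (≮⇒≥ nlt)
        q<L : q < L
        q<L = <-trans (+-cancelʳ-< L q i (subst (_< i + L) (sym q+L≡i+s) (+-monoʳ-< i s<L))) (At-<-length p)
        s≡1+r+q : s ≡ suc r + q
        s≡1+r+q = +-cancelˡ-≡ i s (suc r + q) (begin
          i + s           ≡⟨ q+L≡i+s ⟨
          q + L           ≡⟨ +-comm q L ⟩
          L + q           ≡⟨ cong (_+ q) e ⟨
          suc (i + r) + q ≡⟨ cong suc (+-assoc i r q) ⟩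
          suc (i + (r + q)) ≡⟨ +-suc i (r + q) ⟨
          i + (suc r + q) ∎)
          where open ≡-Reasoning
        i′≡i : q ≡ i
        i′≡i = At-injective U (subst (At l q) (trans (iterate-from-h p {r} w q) (trans (cong (iterate σ x) (sym s≡1+r+q)) σˢx≡x))
                                 (At-iterate q at0 q<L)) p

    next^-length-+ : ∀ a {x} → x ∈ l → iterate σ x (L + a) ≡ iterate σ x a
    next^-length-+ a {x} x∈ = trans (iterate-+ σ x L a) (cong (λ y → iterate σ y a) (next^-length x∈))

    next-injective : ∀ {x y} → x ∈ l → y ∈ l → σ x ≡ σ y → x ≡ y
    next-injective x∈ y∈ e = trans (sym (next^-length x∈)) (trans (cong (λ z → iterate σ z (length t)) e) (next^-length y∈))

    next^-injective : ∀ {x a b} → x ∈ l → a < L → b < L → iterate σ x a ≡ iterate σ x b → a ≡ b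
    next^-injective {x} {a} {b} x∈ a<L b<L e with <-cmp a b
    ... | tri≈ _ a≡b _ = a≡b
    ... | tri< a<b _ _ = ⊥-elim (next^-≢ (b ∸ a) (next^-∈ a x∈) (m<n⇒0<n∸m a<b) (≤-<-trans (m∸n≤m b a) b<L)
                          (trans (sym (iterate-+ σ x a (b ∸ a))) (trans (cong (iterate σ x) (m+[n∸m]≡n (<⇒≤ a<b))) (sym e))))
    ... | tri> _ _ b<a = ⊥-elim (next^-≢ (a ∸ b) (next^-∈ b x∈) (m<n⇒0<n∸m b<a) (≤-<-trans (m∸n≤m a b) a<L)
                          (trans (sym (iterate-+ σ x b (a ∸ b))) (trans (cong (iterate σ x) (m+[n∸m]≡n (<⇒≤ b<a))) e)))

  CycArc⇒next : ∀ l → Unique l → ∀ {a b} → CycArc l a b → a ∈ l × b ≡ next l a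
  CycArc⇒next (h ∷ t) U = NonEmpty.CycArc⇒next h t U

  next-CycArc : ∀ l → Unique l → ∀ {a} → a ∈ l → CycArc l a (next l a)
  next-CycArc (h ∷ t) U = NonEmpty.next-CycArc h t U

  next-∈ : ∀ l → Unique l → ∀ {a} → a ∈ l → next l a ∈ l
  next-∈ (h ∷ t) U = NonEmpty.next-∈ h t U

  next^-∈ : ∀ l → Unique l → ∀ s {x} → x ∈ l → iterate (next l) x s ∈ l
  next^-∈ (h ∷ t) U = NonEmpty.next^-∈ h t U

  next^-length-+ : ∀ l → Unique l → ∀ a {x} → x ∈ l → iterate (next l) x (length l + a) ≡ iterate (next l) x a
  next^-length-+ (h ∷ t) U = NonEmpty.next^-length-+ h t U

  next^-≢ : ∀ l → Unique l → ∀ s {x} → x ∈ l → 0 < s → s < length l → iterate (next l) x s ≢ x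
  next^-≢ (h ∷ t) U = NonEmpty.next^-≢ h t U

  next^-reach : ∀ l → Unique l → ∀ {x y} → x ∈ l → y ∈ l → ∃[ s ] (s < length l × y ≡ iterate (next l) x s)
  next^-reach (h ∷ t) U = NonEmpty.next^-reach h t U

  next-injective : ∀ l → Unique l → ∀ {x y} → x ∈ l → y ∈ l → next l x ≡ next l y → x ≡ y
  next-injective (h ∷ t) U = NonEmpty.next-injective h t U

  next^-injective : ∀ l → Unique l → ∀ {x a b} → x ∈ l → a < length l → b < length l →
                    iterate (next l) x a ≡ iterate (next l) x b → a ≡ b
  next^-injective (h ∷ t) U = NonEmpty.next^-injective h t U

  CycEdge-∈ : ∀ l → Unique l → ∀ {a b} → CycEdge l a b → a ∈ l × b ∈ l
  CycEdge-∈ l U (inj₁ c) = let a∈ , b≡ = CycArc⇒next l U c in a∈ , subst (_∈ l) (sym b≡) (next-∈ l U a∈)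
  CycEdge-∈ l U (inj₂ c) = let b∈ , a≡ = CycArc⇒next l U c in subst (_∈ l) (sym a≡) (next-∈ l U b∈) , b∈

-- Positions t < k on a cycle of length k. The arc from d of length m (d, m < k) covers
-- d, d+1, …, d+m read modulo k; it wraps through 0 exactly when d + m ≥ k.
module CircularArc (k : ℕ) where
  OnArc : ℕ → ℕ → ℕ → Set
  OnArc d m t = (d ≤ t × t ≤ d + m) ⊎ (k + t ≤ d + m)

  OnArcEdge : ℕ → ℕ → ℕ → Set
  OnArcEdge d m t = (d ≤ t × t < d + m) ⊎ (k + t < d + m)

  module _ {d m t : ℕ} (unwrapped : d + m < k) where
    unwrapped-OnArc⇒ : OnArc d m t → d ≤ t × t ≤ d + m
    unwrapped-OnArc⇒ (inj₁ p)   = p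
    unwrapped-OnArc⇒ (inj₂ k+t≤) = ⊥-elim (<-irrefl refl (≤-trans unwrapped (≤-trans (m≤m+n k t) k+t≤)))

    unwrapped-OnArcEdge⇒ : OnArcEdge d m t → d ≤ t × t < d + m
    unwrapped-OnArcEdge⇒ (inj₁ p)   = p
    unwrapped-OnArcEdge⇒ (inj₂ k+t<) = ⊥-elim (<-irrefl refl (≤-trans unwrapped (≤-trans (m≤m+n k t) (<⇒≤ k+t<))))

  -- A wrapped arc is the union of [d, k) and [0, g].
  module _ {d m g : ℕ} (wraps : k + g ≡ d + m) where
    wrapped-OnArc⇒ : ∀ {t} → OnArc d m t → d ≤ t ⊎ t ≤ g
    wrapped-OnArc⇒     (inj₁ (d≤t , _)) = inj₁ d≤t
    wrapped-OnArc⇒ {t} (inj₂ k+t≤)      = inj₂ (+-cancelˡ-≤ k t g (subst (k + t ≤_) (sym wraps) k+t≤))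

    wrapped-OnArc-head : ∀ {t} → d ≤ t → t < k → OnArc d m t
    wrapped-OnArc-head d≤t t<k = inj₁ (d≤t , ≤-trans (<⇒≤ t<k) (subst (k ≤_) wraps (m≤m+n k g)))

    wrapped-OnArc-tail : ∀ {t} → t ≤ g → OnArc d m t
    wrapped-OnArc-tail {t} t≤g = inj₂ (subst (k + t ≤_) wraps (+-monoʳ-≤ k t≤g))

    wrapped-OnArcEdge⇒ : ∀ {t} → OnArcEdge d m t → d ≤ t ⊎ t < g
    wrapped-OnArcEdge⇒     (inj₁ (d≤t , _)) = inj₁ d≤t
    wrapped-OnArcEdge⇒ {t} (inj₂ k+t<)      = inj₂ (+-cancelˡ-< k t g (subst (k + t <_) (sym wraps) k+t<))

    wrapped-OnArcEdge-head : ∀ {t} → d ≤ t → t < k → OnArcEdge d m t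
    wrapped-OnArcEdge-head d≤t t<k = inj₁ (d≤t , ≤-trans t<k (subst (k ≤_) wraps (m≤m+n k g)))

    wrapped-OnArcEdge-tail : ∀ {t} → t < g → OnArcEdge d m t
    wrapped-OnArcEdge-tail {t} t<g = inj₂ (subst (k + t <_) wraps (+-monoʳ-< k t<g))

    wrapped-end<start : m < k → g < d
    wrapped-end<start m<k = +-cancelˡ-< k g d
      (subst (_< k + d) (sym wraps) (subst (d + m <_) (+-comm d k) (+-monoʳ-< d m<k)))

module Cobweb (G : Graph) (C : Cycle G) (cob : IsCobweb G C) where
  open CyclicSuccessor (_≟F_ {Graph.n G})
  open import Data.List.Membership.DecPropositional (_≟F_ {Graph.n G}) using (_∈?_)

  N : ℕ
  N = Graph.n G

  cs : List (Fin N)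
  cs = verts C

  UC : Unique cs
  UC = unique C

  k : ℕ
  k = length cs

  σ : Fin N → Fin N
  σ = next cs

  σ^ : ℕ → Fin N → Fin N
  σ^ j x = iterate σ x j

  open CircularArc k

  E-sym : ∀ {a b} → E G a b → E G b a
  E-sym {a} {b} e = trans (sym (Graph.sym G a b)) e

  0<k : 0 < k
  0<k = ≤-trans (s≤s z≤n) (long C)

  C-adjacent⇒next : ∀ {a b} → a ∈ cs → b ∈ cs → E G a b → b ≡ σ a ⊎ a ≡ σ b
  C-adjacent⇒next a∈ b∈ e with IsCobweb.induced cob _ _ a∈ b∈ e
  ... | inj₁ c = inj₁ (proj₂ (CycArc⇒next cs UC c))
  ... | inj₂ c = inj₂ (proj₂ (CycArc⇒next cs UC c))

  σ^-k : ∀ {y} → y ∈ cs → σ^ k y ≡ y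
  σ^-k {y} y∈ = trans (cong (iterate σ y) (sym (+-identityʳ k))) (next^-length-+ cs UC 0 y∈)

  -- ω(v) − v is the path y, σ y, …, σ^m y of C.
  record WedgeArc {v : Fin N} (W : Wedge G C v) : Set where
    field
      y        : Fin N
      m        : ℕ
      y∈C      : y ∈ cs
      1≤m      : 1 ≤ m
      m<k      : m < k
      vertex⇒  : ∀ x → x ∈ verts (cycle W) → x ≢ v → ∃[ j ] (j ≤ m × x ≡ σ^ j y)
      vertex⇐  : ∀ j → j ≤ m → σ^ j y ∈ verts (cycle W)
      edge⇒    : ∀ a b → CycEdge (verts (cycle W)) a b → a ≢ v → b ≢ v →
                 ∃[ j ] (j < m × ((a ≡ σ^ j y × b ≡ σ^ (suc j) y) ⊎ (b ≡ σ^ j y × a ≡ σ^ (suc j) y)))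
      edge⇐    : ∀ j → j < m → CycEdge (verts (cycle W)) (σ^ j y) (σ^ (suc j) y)
      anchor-edge₀ : CycEdge (verts (cycle W)) v y
      anchor-edgeₘ : CycEdge (verts (cycle W)) v (σ^ m y)
      anchor-adj₀  : E G v y
      anchor-adjₘ  : E G v (σ^ m y)
      anchor-nbrs  : ∀ x → E G v x → x ∈ verts (cycle W) → x ≡ y ⊎ x ≡ σ^ m y

  module WedgeArcConstruction {v : Fin N} (W : Wedge G C v) where
    private
      ws : List (Fin N)
      ws = verts (cycle W)
      Uw : Unique ws
      Uw = unique (cycle W)
      τ : Fin N → Fin N
      τ = next ws
      v∈ : v ∈ ws
      v∈ = anchorIn W

    -- q 0, …, q M are the vertices of W after v, in the cyclic order of W; M + 2 = |W|.
    q : ℕ → Fin N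
    q j = iterate τ v (suc j)

    M : ℕ
    M = length ws ∸ 2

    2+M≡length : suc (suc M) ≡ length ws
    2+M≡length = m+[n∸m]≡n {2} (≤-trans (s≤s (s≤s z≤n)) (long (cycle W)))

    1≤M : 1 ≤ M
    1≤M = +-cancelˡ-≤ 2 1 M (≤-trans (long (cycle W)) (≤-reflexive (sym 2+M≡length)))

    q∈W : ∀ j → q j ∈ ws
    q∈W j = next^-∈ ws Uw (suc j) v∈

    1+j<length : ∀ {j} → j ≤ M → suc j < length ws
    1+j<length j≤M = ≤-trans (s≤s (s≤s j≤M)) (≤-reflexive 2+M≡length)

    q≢anchor : ∀ {j} → j ≤ M → q j ≢ v
    q≢anchor j≤M = next^-≢ ws Uw _ v∈ (s≤s z≤n) (1+j<length j≤M)

    q∈C : ∀ {j} → j ≤ M → q j ∈ cs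
    q∈C {j} j≤M with q j ∈? cs
    ... | yes p = p
    ... | no p  = ⊥-elim (q≢anchor j≤M (onlyAnchor W (q j) (q∈W j) p))

    q-suc : ∀ j → q (suc j) ≡ τ (q j)
    q-suc j = iterate-suc τ v (suc j)

    next-qM : τ (q M) ≡ v
    next-qM = trans (sym (q-suc M))
      (trans (cong (iterate τ v) (trans 2+M≡length (sym (+-identityʳ (length ws))))) (next^-length-+ ws Uw 0 v∈))

    q-distinct : ∀ {i j} → i < j → j ≤ M → q i ≢ q j
    q-distinct {i} {j} i<j j≤M qi≡qj = next^-≢ ws Uw (j ∸ i) (q∈W i) (m<n⇒0<n∸m i<j)
      (≤-trans (s≤s (m∸n≤m j i)) (≤-trans (n≤1+n _) (1+j<length j≤M))) (trans τʲ⁻ⁱqi≡qj (sym qi≡qj))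
      where
        τʲ⁻ⁱqi≡qj : iterate τ (q i) (j ∸ i) ≡ q j
        τʲ⁻ⁱqi≡qj = trans (sym (iterate-+ τ v (suc i) (j ∸ i))) (cong (iterate τ v ∘′ suc) (m+[n∸m]≡n (<⇒≤ i<j)))

    q-CycArc : ∀ j → CycArc ws (q j) (q (suc j))
    q-CycArc j = subst (CycArc ws (q j)) (sym (q-suc j)) (next-CycArc ws Uw (q∈W j))

    q-C-step : ∀ j → j < M → q (suc j) ≡ σ (q j) ⊎ q j ≡ σ (q (suc j))
    q-C-step j j<M = C-adjacent⇒next (q∈C (<⇒≤ j<M)) (q∈C j<M) (edges (cycle W) _ _ (q-CycArc j))

    -- Once the first step of q runs along σ, so do all the others, because q does not repeat.
    forward-everywhere : q 1 ≡ σ (q 0) → ∀ j → j < M → q (suc j) ≡ σ (q j)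
    forward-everywhere first zero    _ = first
    forward-everywhere first (suc j) j+1<M with q-C-step (suc j) j+1<M
    ... | inj₁ e = e
    ... | inj₂ e = ⊥-elim (q-distinct {j} {suc (suc j)} (m<n⇒m<1+n (n<1+n j)) j+1<M
                     (next-injective cs UC (q∈C (≤-trans (n≤1+n _) (≤-trans (n≤1+n _) j+1<M))) (q∈C j+1<M)
                        (trans (sym (forward-everywhere first j (≤-trans (n≤1+n _) j+1<M))) e)))

    backward-everywhere : q 0 ≡ σ (q 1) → ∀ j → j < M → q j ≡ σ (q (suc j))
    backward-everywhere first zero    _ = first
    backward-everywhere first (suc j) j+1<M with q-C-step (suc j) j+1<M
    ... | inj₂ e = e
    ... | inj₁ e = ⊥-elim (q-distinct {j} {suc (suc j)} (m<n⇒m<1+n (n<1+n j)) j+1<M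
                     (trans (backward-everywhere first j (≤-trans (n≤1+n _) j+1<M)) (sym e)))

    q-index : ∀ {x} → x ∈ ws → x ≢ v → ∃[ j ] (j ≤ M × x ≡ q j)
    q-index x∈ x≢v with next^-reach ws Uw v∈ x∈
    ... | zero  , _   , e = ⊥-elim (x≢v e)
    ... | suc j , j<L , e = j , ≤-pred (≤-pred (≤-trans j<L (≤-reflexive (sym 2+M≡length)))) , e

    CycArc⇒q-step : ∀ {a b} → CycArc ws a b → a ≢ v → b ≢ v → ∃[ j ] (j < M × a ≡ q j × b ≡ q (suc j))
    CycArc⇒q-step c a≢v b≢v with CycArc⇒next ws Uw c
    ... | a∈ , b≡ with q-index a∈ a≢v
    ... | j , j≤M , a≡ with m≤n⇒m<n∨m≡n j≤M
    ... | inj₁ j<M = j , j<M , a≡ , trans b≡ (trans (cong τ a≡) (sym (q-suc j)))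
    ... | inj₂ refl = ⊥-elim (b≢v (trans b≡ (trans (cong τ a≡) next-qM)))

    anchor-CycArc-q0 : CycArc ws v (q 0)
    anchor-CycArc-q0 = next-CycArc ws Uw v∈

    qM-CycArc-anchor : CycArc ws (q M) v
    qM-CycArc-anchor = subst (CycArc ws (q M)) next-qM (next-CycArc ws Uw (q∈W M))

    anchor-adj-q0 : E G v (q 0)
    anchor-adj-q0 = edges (cycle W) _ _ anchor-CycArc-q0

    anchor-adj-qM : E G v (q M)
    anchor-adj-qM = E-sym (edges (cycle W) _ _ qM-CycArc-anchor)

    anchor-nbrs : ∀ x → E G v x → x ∈ ws → x ≡ q 0 ⊎ x ≡ q M
    anchor-nbrs x e x∈
      with onlyTwo W x e x∈ | onlyTwo W (q 0) anchor-adj-q0 (q∈W 0) | onlyTwo W (q M) anchor-adj-qM (q∈W M)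
    ... | inj₁ x≡a | inj₁ q0≡a | _          = inj₁ (trans x≡a (sym q0≡a))
    ... | inj₂ x≡b | _         | inj₂ qM≡b  = inj₂ (trans x≡b (sym qM≡b))
    ... | inj₁ x≡a | inj₂ _    | inj₁ qM≡a  = inj₂ (trans x≡a (sym qM≡a))
    ... | inj₁ _   | inj₂ q0≡b | inj₂ qM≡b  = ⊥-elim (q-distinct 1≤M ≤-refl (trans q0≡b (sym qM≡b)))
    ... | inj₂ _   | inj₁ q0≡a | inj₁ qM≡a  = ⊥-elim (q-distinct 1≤M ≤-refl (trans q0≡a (sym qM≡a)))
    ... | inj₂ x≡b | inj₂ q0≡b | inj₁ _     = inj₁ (trans x≡b (sym q0≡b))

    forwardArc : (∀ j → j < M → q (suc j) ≡ σ (q j)) → WedgeArc W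
    forwardArc fwd = record
      { y = q 0 ; m = M ; y∈C = q∈C z≤n ; 1≤m = 1≤M ; m<k = M<k
      ; vertex⇒ = λ x x∈ x≢v → let j , j≤M , x≡ = q-index x∈ x≢v in j , j≤M , trans x≡ (q≡σ^ j j≤M)
      ; vertex⇐ = λ j j≤M → subst (_∈ ws) (q≡σ^ j j≤M) (q∈W j)
      ; edge⇒ = edge⇒
      ; edge⇐ = λ j j<M → inj₁ (subst₂ (CycArc ws) (q≡σ^ j (<⇒≤ j<M)) (q≡σ^ (suc j) j<M) (q-CycArc j))
      ; anchor-edge₀ = inj₁ anchor-CycArc-q0
      ; anchor-edgeₘ = inj₂ (subst (λ z → CycArc ws z v) (q≡σ^ M ≤-refl) qM-CycArc-anchor)
      ; anchor-adj₀ = anchor-adj-q0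
      ; anchor-adjₘ = subst (E G v) (q≡σ^ M ≤-refl) anchor-adj-qM
      ; anchor-nbrs = λ x e x∈ → Sum.map₂ (λ x≡ → trans x≡ (q≡σ^ M ≤-refl)) (anchor-nbrs x e x∈)
      }
      where
        q≡σ^ : ∀ j → j ≤ M → q j ≡ σ^ j (q 0)
        q≡σ^ zero    _     = refl
        q≡σ^ (suc j) j+1≤M =
          trans (fwd j j+1≤M) (trans (cong σ (q≡σ^ j (<⇒≤ j+1≤M))) (sym (iterate-suc σ (q 0) j)))

        M<k : M < k
        M<k with M <? k
        ... | yes p = p
        ... | no p  = ⊥-elim (q-distinct {0} {k} 0<k (≮⇒≥ p) (sym (trans (q≡σ^ k (≮⇒≥ p)) (σ^-k (q∈C z≤n)))))

        edge⇒ : ∀ a b → CycEdge ws a b → a ≢ v → b ≢ v →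
                ∃[ j ] (j < M × ((a ≡ σ^ j (q 0) × b ≡ σ^ (suc j) (q 0)) ⊎ (b ≡ σ^ j (q 0) × a ≡ σ^ (suc j) (q 0))))
        edge⇒ a b (inj₁ c) a≢v b≢v with CycArc⇒q-step c a≢v b≢v
        ... | j , j<M , a≡ , b≡ = j , j<M , inj₁ (trans a≡ (q≡σ^ j (<⇒≤ j<M)) , trans b≡ (q≡σ^ (suc j) j<M))
        edge⇒ a b (inj₂ c) a≢v b≢v with CycArc⇒q-step c b≢v a≢v
        ... | j , j<M , b≡ , a≡ = j , j<M , inj₂ (trans b≡ (q≡σ^ j (<⇒≤ j<M)) , trans a≡ (q≡σ^ (suc j) j<M))

    backwardArc : (∀ j → j < M → q j ≡ σ (q (suc j))) → WedgeArc W
    backwardArc bwd = record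
      { y = q M ; m = M ; y∈C = q∈C ≤-refl ; 1≤m = 1≤M ; m<k = M<k
      ; vertex⇒ = λ x x∈ x≢v → let j , j≤M , x≡ = q-index x∈ x≢v in M ∸ j , m∸n≤m M j , trans x≡ (q≡σ^M∸ j j≤M)
      ; vertex⇐ = λ d d≤M → subst (_∈ ws) (qM∸≡σ^ d d≤M) (q∈W (M ∸ d))
      ; edge⇒ = edge⇒
      ; edge⇐ = λ d d<M → inj₂ (subst₂ (CycArc ws) (qM∸≡σ^ (suc d) d<M)
                   (trans (cong q (1+M∸1+d d<M)) (qM∸≡σ^ d (<⇒≤ d<M))) (q-CycArc (M ∸ suc d)))
      ; anchor-edge₀ = inj₂ qM-CycArc-anchor
      ; anchor-edgeₘ = inj₁ (subst (CycArc ws v) (q≡σ^M∸ 0 z≤n) anchor-CycArc-q0)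
      ; anchor-adj₀ = anchor-adj-qM
      ; anchor-adjₘ = subst (E G v) (q≡σ^M∸ 0 z≤n) anchor-adj-q0
      ; anchor-nbrs = λ x e x∈ → Sum.swap (Sum.map₁ (λ x≡ → trans x≡ (q≡σ^M∸ 0 z≤n)) (anchor-nbrs x e x∈))
      }
      where
        1+M∸1+d : ∀ {d} → d < M → suc (M ∸ suc d) ≡ M ∸ d
        1+M∸1+d d<M = sym (+-∸-assoc 1 d<M)

        qM∸≡σ^ : ∀ d → d ≤ M → q (M ∸ d) ≡ σ^ d (q M)
        qM∸≡σ^ zero    _     = refl
        qM∸≡σ^ (suc d) d+1≤M =
          trans (bwd (M ∸ suc d) (∸-monoʳ-< (s≤s z≤n) d+1≤M))
            (trans (cong (σ ∘′ q) (1+M∸1+d d+1≤M))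
              (trans (cong σ (qM∸≡σ^ d (<⇒≤ d+1≤M))) (sym (iterate-suc σ (q M) d))))

        q≡σ^M∸ : ∀ j → j ≤ M → q j ≡ σ^ (M ∸ j) (q M)
        q≡σ^M∸ j j≤M = trans (cong q (sym (m∸[m∸n]≡n j≤M))) (qM∸≡σ^ (M ∸ j) (m∸n≤m M j))

        M<k : M < k
        M<k with M <? k
        ... | yes p = p
        ... | no p  = ⊥-elim (q-distinct {M ∸ k} {M} (∸-monoʳ-< 0<k (≮⇒≥ p)) ≤-refl
                         (trans (qM∸≡σ^ k (≮⇒≥ p)) (σ^-k (q∈C ≤-refl))))

        edge⇒ : ∀ a b → CycEdge ws a b → a ≢ v → b ≢ v →
                ∃[ j ] (j < M × ((a ≡ σ^ j (q M) × b ≡ σ^ (suc j) (q M)) ⊎ (b ≡ σ^ j (q M) × a ≡ σ^ (suc j) (q M))))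
        edge⇒ a b (inj₁ c) a≢v b≢v with CycArc⇒q-step c a≢v b≢v
        ... | j , j<M , a≡ , b≡ = M ∸ suc j , ∸-monoʳ-< (s≤s z≤n) j<M ,
              inj₂ (trans b≡ (q≡σ^M∸ (suc j) j<M) ,
                    trans a≡ (trans (q≡σ^M∸ j (<⇒≤ j<M)) (cong (λ i → σ^ i (q M)) (sym (1+M∸1+d j<M)))))
        edge⇒ a b (inj₂ c) a≢v b≢v with CycArc⇒q-step c b≢v a≢v
        ... | j , j<M , b≡ , a≡ = M ∸ suc j , ∸-monoʳ-< (s≤s z≤n) j<M ,
              inj₁ (trans a≡ (q≡σ^M∸ (suc j) j<M) ,
                    trans b≡ (trans (q≡σ^M∸ j (<⇒≤ j<M)) (cong (λ i → σ^ i (q M)) (sym (1+M∸1+d j<M)))))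

  opaque
    wedgeArc : ∀ {v} (W : Wedge G C v) → WedgeArc W
    wedgeArc W = Sum.[_,_]′ (forwardArc ∘′ forward-everywhere) (backwardArc ∘′ backward-everywhere) (q-C-step 0 1≤M)
      where open WedgeArcConstruction W

  I-nbr∈C : ∀ {a z} → InI G C a → E G a z → z ∈ cs
  I-nbr∈C {a} {z} a∈I e with z ∈? cs
  ... | yes p = p
  ... | no p  = ⊥-elim (IsCobweb.I-indep cob a z a∈I p e)

  wedge-vertex∈C : ∀ {a} (W : Wedge G C a) {x} → x ∈ verts (cycle W) → x ≢ a → x ∈ cs
  wedge-vertex∈C W {x} x∈W x≢a with x ∈? cs
  ... | yes p = p
  ... | no p  = ⊥-elim (x≢a (onlyAnchor W x x∈W p))

  C-vertex≢I : ∀ {a x} → InI G C a → x ∈ cs → x ≢ a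
  C-vertex≢I a∈I x∈C refl = a∈I x∈C

  module Coordinates (x0 : Fin N) (x0∈C : x0 ∈ cs) where
    P : ℕ → Fin N
    P t = σ^ t x0

    P∈C : ∀ t → P t ∈ cs
    P∈C t = next^-∈ cs UC t x0∈C

    P≢I : ∀ {a} → InI G C a → ∀ t → P t ≢ a
    P≢I a∈I t = C-vertex≢I a∈I (P∈C t)

    opaque
      coordinate : ∀ {z} → z ∈ cs → ∃[ t ] (t < k × z ≡ P t)
      coordinate = next^-reach cs UC x0∈C

    P-injective : ∀ {a b} → a < k → b < k → P a ≡ P b → a ≡ b
    P-injective = next^-injective cs UC x0∈C

    P-k+ : ∀ t → P (k + t) ≡ P t
    P-k+ t = next^-length-+ cs UC t x0∈C

    P-suc : ∀ t → P (suc t) ≡ σ (P t)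
    P-suc = iterate-suc σ x0

    σ^-P : ∀ d j → σ^ j (P d) ≡ P (d + j)
    σ^-P d j = sym (iterate-+ σ x0 d j)

    opaque
      P-reduce : ∀ a → a < k + k → ∃[ t ] (t < k × P a ≡ P t × (t ≡ a ⊎ k + t ≡ a))
      P-reduce a a<2k with a <? k
      ... | yes a<k = a , a<k , refl , inj₁ refl
      ... | no a≮k  = a ∸ k , +-cancelˡ-< k (a ∸ k) k (subst (_< k + k) (sym k+[a∸k]≡a) a<2k) ,
                      trans (cong P (sym k+[a∸k]≡a)) (P-k+ (a ∸ k)) , inj₂ k+[a∸k]≡a
        where
          k+[a∸k]≡a : k + (a ∸ k) ≡ a
          k+[a∸k]≡a = m+[n∸m]≡n (≮⇒≥ a≮k)

    -- Needs k ≥ 3.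
    P-2+≢ : ∀ t → P (suc (suc t)) ≢ P t
    P-2+≢ t e = next^-≢ cs UC 2 (P∈C t) (s≤s z≤n) (long C)
                  (trans (sym (iterate-+ σ x0 t 2)) (trans (cong P (+-comm t 2)) e))

    Oriented : Fin N → Fin N → ℕ → Set
    Oriented a b t = (a ≡ P t × b ≡ P (suc t)) ⊎ (b ≡ P t × a ≡ P (suc t))

    Oriented-unique : ∀ {a b t t′} → t < k → t′ < k → Oriented a b t → Oriented a b t′ → t ≡ t′
    Oriented-unique t<k t′<k (inj₁ (a≡ , _)) (inj₁ (a≡′ , _)) = P-injective t<k t′<k (trans (sym a≡) a≡′)
    Oriented-unique t<k t′<k (inj₂ (b≡ , _)) (inj₂ (b≡′ , _)) = P-injective t<k t′<k (trans (sym b≡) b≡′)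
    Oriented-unique {t = t} {t′} _ _ (inj₁ (a≡ , b≡)) (inj₂ (b≡′ , a≡′)) =
      ⊥-elim (P-2+≢ t (trans (P-suc (suc t)) (trans (cong σ (trans (sym b≡) b≡′)) (trans (sym (P-suc t′)) (trans (sym a≡′) a≡)))))
    Oriented-unique {t = t} {t′} _ _ (inj₂ (b≡ , a≡)) (inj₁ (a≡′ , b≡′)) =
      ⊥-elim (P-2+≢ t (trans (P-suc (suc t)) (trans (cong σ (trans (sym a≡) a≡′)) (trans (sym (P-suc t′)) (trans (sym b≡′) b≡)))))

    module ArcCoordinates {a : Fin N} (W : Wedge G C a) (A : WedgeArc W) (d : ℕ) (d<k : d < k)
                          (y≡Pd : WedgeArc.y A ≡ P d) where
      open WedgeArc A
      private
        wl : List (Fin N)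
        wl = verts (cycle W)

        d+j<2k : ∀ {j} → j ≤ m → d + j < k + k
        d+j<2k j≤m = ≤-trans (s≤s (+-monoʳ-≤ d j≤m)) (≤-trans (+-monoˡ-≤ m d<k) (+-monoʳ-≤ k (<⇒≤ m<k)))

        d≤k+t : ∀ t → d ≤ k + t
        d≤k+t t = ≤-trans (<⇒≤ d<k) (m≤m+n k t)

        offset : ∀ {t} → OnArc d m t → ∃[ j ] (j ≤ m × P (d + j) ≡ P t)
        offset {t} (inj₁ (d≤t , t≤d+m)) = t ∸ d ,
          +-cancelˡ-≤ d (t ∸ d) m (subst (_≤ d + m) (sym (m+[n∸m]≡n d≤t)) t≤d+m) , cong P (m+[n∸m]≡n d≤t)
        offset {t} (inj₂ k+t≤d+m) = (k + t) ∸ d ,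
          +-cancelˡ-≤ d _ m (subst (_≤ d + m) (sym (m+[n∸m]≡n (d≤k+t t))) k+t≤d+m) ,
          trans (cong P (m+[n∸m]≡n (d≤k+t t))) (P-k+ t)

        edge-offset : ∀ {t} → OnArcEdge d m t → ∃[ j ] (j < m × P (d + j) ≡ P t)
        edge-offset {t} (inj₁ (d≤t , t<d+m)) = t ∸ d ,
          +-cancelˡ-< d (t ∸ d) m (subst (_< d + m) (sym (m+[n∸m]≡n d≤t)) t<d+m) , cong P (m+[n∸m]≡n d≤t)
        edge-offset {t} (inj₂ k+t<d+m) = (k + t) ∸ d ,
          +-cancelˡ-< d _ m (subst (_< d + m) (sym (m+[n∸m]≡n (d≤k+t t))) k+t<d+m) ,
          trans (cong P (m+[n∸m]≡n (d≤k+t t))) (P-k+ t)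

      σ^y≡P : ∀ j → σ^ j y ≡ P (d + j)
      σ^y≡P j = trans (cong (σ^ j) y≡Pd) (σ^-P d j)

      private
        σ^1+y≡P : ∀ j t → P (d + j) ≡ P t → σ^ (suc j) y ≡ P (suc t)
        σ^1+y≡P j t e = trans (iterate-suc σ y j) (trans (cong σ (trans (σ^y≡P j) e)) (sym (P-suc t)))

      vertex⇒OnArc : ∀ x → x ∈ wl → x ≢ a → ∃[ t ] (t < k × x ≡ P t × OnArc d m t)
      vertex⇒OnArc x x∈ x≢a with vertex⇒ x x∈ x≢a
      ... | j , j≤m , x≡ with P-reduce (d + j) (d+j<2k j≤m)
      ... | t , t<k , P≡ , inj₁ t≡ = t , t<k , trans x≡ (trans (σ^y≡P j) P≡) ,
              inj₁ (subst (d ≤_) (sym t≡) (m≤m+n d j) , subst (_≤ d + m) (sym t≡) (+-monoʳ-≤ d j≤m))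
      ... | t , t<k , P≡ , inj₂ k+t≡ = t , t<k , trans x≡ (trans (σ^y≡P j) P≡) ,
              inj₂ (subst (_≤ d + m) (sym k+t≡) (+-monoʳ-≤ d j≤m))

      OnArc⇒vertex : ∀ {t} → t < k → OnArc d m t → P t ∈ wl
      OnArc⇒vertex t<k on with offset on
      ... | j , j≤m , e = subst (_∈ wl) (trans (σ^y≡P j) e) (vertex⇐ j j≤m)

      OnArcEdge⇒edge : ∀ {t} → t < k → OnArcEdge d m t → CycEdge wl (P t) (P (suc t))
      OnArcEdge⇒edge {t} t<k on with edge-offset on
      ... | j , j<m , e = Sum.map (subst₂ (CycArc wl) (trans (σ^y≡P j) e) (σ^1+y≡P j t e))
                                  (subst₂ (CycArc wl) (σ^1+y≡P j t e) (trans (σ^y≡P j) e)) (edge⇐ j j<m)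

      edge⇒OnArcEdge : ∀ a′ b′ → CycEdge wl a′ b′ → a′ ≢ a → b′ ≢ a →
                       ∃[ t ] (t < k × OnArcEdge d m t × Oriented a′ b′ t)
      edge⇒OnArcEdge a′ b′ c a′≢a b′≢a with edge⇒ a′ b′ c a′≢a b′≢a
      ... | j , j<m , o with P-reduce (d + j) (d+j<2k (<⇒≤ j<m))
      ... | t , t<k , P≡ , t≡ = t , t<k , on t≡ , oriented o
        where
          on : t ≡ d + j ⊎ k + t ≡ d + j → OnArcEdge d m t
          on (inj₁ t≡)   = inj₁ (subst (d ≤_) (sym t≡) (m≤m+n d j) , subst (_< d + m) (sym t≡) (+-monoʳ-< d j<m))
          on (inj₂ k+t≡) = inj₂ (subst (_< d + m) (sym k+t≡) (+-monoʳ-< d j<m))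
          oriented : (a′ ≡ σ^ j y × b′ ≡ σ^ (suc j) y) ⊎ (b′ ≡ σ^ j y × a′ ≡ σ^ (suc j) y) → Oriented a′ b′ t
          oriented (inj₁ (a′≡ , b′≡)) = inj₁ (trans a′≡ (trans (σ^y≡P j) P≡) , trans b′≡ (σ^1+y≡P j t P≡))
          oriented (inj₂ (b′≡ , a′≡)) = inj₂ (trans b′≡ (trans (σ^y≡P j) P≡) , trans a′≡ (σ^1+y≡P j t P≡))

      private
        end : ∃[ t ] (t < k × P (d + m) ≡ P t × (t ≡ d + m ⊎ k + t ≡ d + m))
        end = P-reduce (d + m) (d+j<2k ≤-refl)

      e : ℕ
      e = proj₁ end

      e<k : e < k
      e<k = proj₁ (proj₂ end)

      σ^m≡Pe : σ^ m y ≡ P e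
      σ^m≡Pe = trans (σ^y≡P m) (proj₁ (proj₂ (proj₂ end)))

      e-spec : e ≡ d + m ⊎ k + e ≡ d + m
      e-spec = proj₂ (proj₂ (proj₂ end))

      anchor-nbrs-P : ∀ x → E G a x → x ∈ wl → x ≡ P d ⊎ x ≡ P e
      anchor-nbrs-P x ax x∈ = Sum.map (λ x≡ → trans x≡ y≡Pd) (λ x≡ → trans x≡ σ^m≡Pe) (anchor-nbrs x ax x∈)

      vertex-OnArc : ∀ {x t} → x ∈ wl → x ≢ a → t < k → x ≡ P t → OnArc d m t
      vertex-OnArc {x} x∈ x≢a t<k x≡ with vertex⇒OnArc x x∈ x≢a
      ... | t′ , t′<k , x≡′ , on = subst (OnArc d m) (P-injective t′<k t<k (trans (sym x≡′) x≡)) on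

    module ArcComparison {a₁ a₂ : Fin N} (a₁∈I : InI G C a₁) (a₂∈I : InI G C a₂)
        (W₁ : Wedge G C a₁) (A₁ : WedgeArc W₁) (d₁ : ℕ) (d₁<k : d₁ < k) (y₁≡ : WedgeArc.y A₁ ≡ P d₁)
        (W₂ : Wedge G C a₂) (A₂ : WedgeArc W₂) (d₂ : ℕ) (d₂<k : d₂ < k) (y₂≡ : WedgeArc.y A₂ ≡ P d₂) where
      module R₁ = ArcCoordinates W₁ A₁ d₁ d₁<k y₁≡
      module R₂ = ArcCoordinates W₂ A₂ d₂ d₂<k y₂≡
      private
        m₁ m₂ : ℕ
        m₁ = WedgeArc.m A₁
        m₂ = WedgeArc.m A₂
        w₁ w₂ : List (Fin N)
        w₁ = verts (cycle W₁)
        w₂ = verts (cycle W₂)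

        oriented-CycEdge : ∀ {l a b t} → Oriented a b t → CycEdge l (P t) (P (suc t)) → CycEdge l a b
        oriented-CycEdge (inj₁ (refl , refl)) c = c
        oriented-CycEdge (inj₂ (refl , refl)) c = Sum.swap c

      OnArc-⊂⇒Improves : (∀ t → t < k → OnArc d₁ m₁ t → OnArc d₂ m₂ t) →
                         (∀ t → t < k → OnArcEdge d₁ m₁ t → OnArcEdge d₂ m₂ t) →
                         ∀ t₀ → t₀ < k → OnArc d₂ m₂ t₀ → ¬ OnArc d₁ m₁ t₀ → Improves G C W₁ W₂
      OnArc-⊂⇒Improves vs es t₀ t₀<k on₂ ¬on₁ = (vertices-⊆ , edges-⊆) , not-⊇
        where
          vertices-⊆ : ∀ x → V (wsub G C W₁ ─ a₁) x → V (wsub G C W₂ ─ a₂) x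
          vertices-⊆ x (x∈ , x≢a₁) with R₁.vertex⇒OnArc x x∈ x≢a₁
          ... | t , t<k , refl , on = R₂.OnArc⇒vertex t<k (vs t t<k on) , C-vertex≢I a₂∈I (wedge-vertex∈C W₁ x∈ x≢a₁)

          edges-⊆ : ∀ a b → Ed (wsub G C W₁ ─ a₁) a b → Ed (wsub G C W₂ ─ a₂) a b
          edges-⊆ a b (c , a≢a₁ , b≢a₁) with R₁.edge⇒OnArcEdge a b c a≢a₁ b≢a₁ | CycEdge-∈ w₁ (unique (cycle W₁)) c
          ... | t , t<k , on , o | a∈ , b∈ = oriented-CycEdge {t = t} o (R₂.OnArcEdge⇒edge t<k (es t t<k on)) ,
                C-vertex≢I a₂∈I (wedge-vertex∈C W₁ a∈ a≢a₁) , C-vertex≢I a₂∈I (wedge-vertex∈C W₁ b∈ b≢a₁)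

          not-⊇ : ¬ ((wsub G C W₂ ─ a₂) ⊆G (wsub G C W₁ ─ a₁))
          not-⊇ (vs′ , _) with vs′ (P t₀) (R₂.OnArc⇒vertex t₀<k on₂ , P≢I a₂∈I t₀)
          ... | x∈ , x≢a₁ = ¬on₁ (R₁.vertex-OnArc x∈ x≢a₁ t₀<k refl)

      OnArcEdge-⊈⇒¬Improves : ∀ t₀ → t₀ < k → OnArcEdge d₁ m₁ t₀ → ¬ OnArcEdge d₂ m₂ t₀ → ¬ Improves G C W₁ W₂
      OnArcEdge-⊈⇒¬Improves t₀ t₀<k on₁ ¬on₂ ((_ , es) , _)
        with es (P t₀) (P (suc t₀)) (R₁.OnArcEdge⇒edge t₀<k on₁ , P≢I a₁∈I t₀ , P≢I a₁∈I (suc t₀))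
      ... | c , a≢ , b≢ with R₂.edge⇒OnArcEdge _ _ c a≢ b≢
      ... | t , t<k , on₂ , o = ¬on₂ (subst (OnArcEdge d₂ m₂) (Oriented-unique t<k t₀<k o (inj₁ (refl , refl))) on₂)

      -- Otherwise N(a₁) ⊆ N(a₂), which a cobweb forbids.
      attached-arcs-differ : a₁ ≢ a₂ → (∀ z → E G a₁ z → z ∈ w₂) → ¬ (d₁ ≡ d₂ × m₁ ≡ m₂)
      attached-arcs-differ a₁≢a₂ attached (refl , refl) = IsCobweb.nonNested cob a₁ a₂ a₁∈I a₂∈I a₁≢a₂ nested
        where
          nested : ∀ z → E G a₁ z → E G a₂ z
          nested z a₁z with R₂.vertex⇒OnArc z (attached z a₁z) (C-vertex≢I a₂∈I (I-nbr∈C a₁∈I a₁z))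
          ... | t , t<k , z≡ , on with R₁.anchor-nbrs-P z a₁z (subst (_∈ w₁) (sym z≡) (R₁.OnArc⇒vertex t<k on))
          ... | inj₁ z≡Pd = subst (E G a₂) (sym (trans z≡Pd (sym y₂≡))) (WedgeArc.anchor-adj₀ A₂)
          ... | inj₂ z≡Pe = subst (E G a₂) (sym (trans z≡Pe (trans (sym R₁.σ^m≡Pe) (trans (R₁.σ^y≡P m₁)
                               (sym (R₂.σ^y≡P m₂)))))) (WedgeArc.anchor-adjₘ A₂)

  -- Coordinates are based at the start of the arc of ω(u), so ω(u) − u covers [0, mu]
  -- and ω(v) − v covers the arc from dv of length mv.
  module TwoWedges {u v : Fin N} (Wu : Wedge G C u) (Wv : Wedge G C v) where
    Au : WedgeArc Wu
    Au = wedgeArc Wu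
    Av : WedgeArc Wv
    Av = wedgeArc Wv

    open Coordinates (WedgeArc.y Au) (WedgeArc.y∈C Au) public

    mu mv : ℕ
    mu = WedgeArc.m Au
    mv = WedgeArc.m Av

    mu<k : mu < k
    mu<k = WedgeArc.m<k Au

    private
      v-start : ∃[ t ] (t < k × WedgeArc.y Av ≡ P t)
      v-start = coordinate (WedgeArc.y∈C Av)

    dv : ℕ
    dv = proj₁ v-start

    dv<k : dv < k
    dv<k = proj₁ (proj₂ v-start)

    yv≡Pdv : WedgeArc.y Av ≡ P dv
    yv≡Pdv = proj₂ (proj₂ v-start)

    module RU = ArcCoordinates Wu Au 0 0<k refl
    module RV = ArcCoordinates Wv Av dv dv<k yv≡Pdv

    H : Sub N
    H = wsub G C Wu ∩ wsub G C Wv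

    H-edge-sym : ∀ a b → Ed H a b → Ed H b a
    H-edge-sym a b (cu , cv) = Sum.swap cu , Sum.swap cv

    OnArc-u⇒≤mu : ∀ {t} → OnArc 0 mu t → t ≤ mu
    OnArc-u⇒≤mu on = proj₂ (unwrapped-OnArc⇒ mu<k on)

    OnArcEdge-u⇒<mu : ∀ {t} → OnArcEdge 0 mu t → t < mu
    OnArcEdge-u⇒<mu on = proj₂ (unwrapped-OnArcEdge⇒ mu<k on)

    ≤mu⇒vertex-u : ∀ {t} → t ≤ mu → P t ∈ verts (cycle Wu)
    ≤mu⇒vertex-u t≤mu = RU.OnArc⇒vertex (≤-<-trans t≤mu mu<k) (inj₁ (z≤n , t≤mu))

  module DistinctAnchors (ω : WedgeSelection G C) (u v : Fin N) (u∈I : InI G C u) (v∈I : InI G C v)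
                         (u≢v : u ≢ v) where
    Wu : Wedge G C u
    Wu = ω u u∈I
    Wv : Wedge G C v
    Wv = ω v v∈I

    open TwoWedges Wu Wv public

    InH : ℕ → Set
    InH t = t < k × t ≤ mu × OnArc dv mv t

    EdgeInH : ℕ → Set
    EdgeInH t = t < mu × OnArcEdge dv mv t

    private
      Wv-vertex≢u : ∀ {x} → x ∈ verts (cycle Wv) → x ≢ u
      Wv-vertex≢u x∈ refl = u≢v (onlyAnchor Wv u x∈ u∈I)

      Wu-vertex≢v : ∀ {x} → x ∈ verts (cycle Wu) → x ≢ v
      Wu-vertex≢v x∈ refl = u≢v (sym (onlyAnchor Wu v x∈ v∈I))

    H-vertex⇒InH : ∀ {x} → V H x → ∃[ t ] (x ≡ P t × InH t)
    H-vertex⇒InH {x} (x∈u , x∈v) with RU.vertex⇒OnArc x x∈u (Wv-vertex≢u x∈v)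
    ... | t , t<k , x≡ , on = t , x≡ , t<k , OnArc-u⇒≤mu on , RV.vertex-OnArc x∈v (Wu-vertex≢v x∈u) t<k x≡

    H-vertex-P⇒InH : ∀ {t} → t < k → V H (P t) → InH t
    H-vertex-P⇒InH t<k x∈H with H-vertex⇒InH x∈H
    ... | t′ , Pt≡Pt′ , in-H = subst InH (P-injective (proj₁ in-H) t<k (sym Pt≡Pt′)) in-H

    InH⇒H-vertex : ∀ {t} → InH t → V H (P t)
    InH⇒H-vertex (t<k , t≤mu , on) = RU.OnArc⇒vertex t<k (inj₁ (z≤n , t≤mu)) , RV.OnArc⇒vertex t<k on

    H-edge⇒EdgeInH : ∀ {a b} → Ed H a b → ∃[ t ] (t < k × EdgeInH t × Oriented a b t)
    H-edge⇒EdgeInH {a} {b} (cu , cv) with CycEdge-∈ _ (unique (cycle Wu)) cu | CycEdge-∈ _ (unique (cycle Wv)) cv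
    ... | a∈u , b∈u | a∈v , b∈v
      with RU.edge⇒OnArcEdge a b cu (Wv-vertex≢u a∈v) (Wv-vertex≢u b∈v)
         | RV.edge⇒OnArcEdge a b cv (Wu-vertex≢v a∈u) (Wu-vertex≢v b∈u)
    ... | t , t<k , onu , o | t′ , t′<k , onv , o′ =
      t , t<k , (OnArcEdge-u⇒<mu onu , subst (OnArcEdge dv mv) (Oriented-unique t′<k t<k o′ o) onv) , o

    EdgeInH⇒H-edge : ∀ {t} → EdgeInH t → Ed H (P t) (P (suc t))
    EdgeInH⇒H-edge {t} (t<mu , on) = RU.OnArcEdge⇒edge t<k (inj₁ (z≤n , t<mu)) , RV.OnArcEdge⇒edge t<k on
      where
        t<k : t < k
        t<k = <-trans t<mu mu<k

    Conn-within : (S : ℕ → Set) → (∀ {t} → S t → InH t) →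
                  (∀ {a b t} → S a → S b → a ≤ t → t ≤ b → S t) →
                  (∀ {t} → S t → S (suc t) → EdgeInH t) →
                  ∀ {a b} → S a → S b → Conn H (P a) (P b)
    Conn-within S S⇒InH convex edge {a} {b} sa sb =
      Sum.[ along sa sb , (λ b≤a → Conn-sym H-edge-sym (along sb sa b≤a)) ]′ (≤-total a b)
      where
        along : ∀ {a b} → S a → S b → a ≤ b → Conn H (P a) (P b)
        along sa sb a≤b = Conn-along P a≤b (λ t a≤t t≤b → InH⇒H-vertex (S⇒InH (convex sa sb a≤t t≤b)))
          (λ t a≤t t<b → EdgeInH⇒H-edge (edge (convex sa sb a≤t (<⇒≤ t<b)) (convex sa sb (m≤n⇒m≤1+n a≤t) t<b)))

    data Shape : Set where
      unwrapped : dv + mv < k → Shape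
      wrapped   : (g : ℕ) → k + g ≡ dv + mv → Shape

    shape : Shape
    shape with dv + mv <? k
    ... | yes p = unwrapped p
    ... | no p  = wrapped (dv + mv ∸ k) (m+[n∸m]≡n (≮⇒≥ p))

    unwrapped-Conn : dv + mv < k → ∀ {a b} → InH a → InH b → Conn H (P a) (P b)
    unwrapped-Conn unwr = Conn-within InH (λ h → h) convex edge
      where
        convex : ∀ {a b t} → InH a → InH b → a ≤ t → t ≤ b → InH t
        convex (_ , _ , ona) (b<k , b≤mu , onb) a≤t t≤b =
          ≤-<-trans t≤b b<k , ≤-trans t≤b b≤mu ,
          inj₁ (≤-trans (proj₁ (unwrapped-OnArc⇒ unwr ona)) a≤t , ≤-trans t≤b (proj₂ (unwrapped-OnArc⇒ unwr onb)))
        edge : ∀ {t} → InH t → InH (suc t) → EdgeInH t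
        edge (_ , _ , on) (_ , 1+t≤mu , on′) =
          1+t≤mu , inj₁ (proj₁ (unwrapped-OnArc⇒ unwr on) , proj₂ (unwrapped-OnArc⇒ unwr on′))

    -- When the arc of ω(v) wraps, H splits into a head part (coordinates ≥ dv) and a tail part (≤ g).
    module Wrapped {g : ℕ} (wraps : k + g ≡ dv + mv) where
      g<dv : g < dv
      g<dv = wrapped-end<start wraps (WedgeArc.m<k Av)

      Head Tail : ℕ → Set
      Head t = InH t × dv ≤ t
      Tail t = InH t × t ≤ g

      InH⇒Head⊎Tail : ∀ {t} → InH t → Head t ⊎ Tail t
      InH⇒Head⊎Tail h@(_ , _ , on) = Sum.map (h ,_) (h ,_) (wrapped-OnArc⇒ wraps on)

      Head-Conn : ∀ {a b} → Head a → Head b → Conn H (P a) (P b)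
      Head-Conn = Conn-within Head proj₁ convex edge
        where
          convex : ∀ {a b t} → Head a → Head b → a ≤ t → t ≤ b → Head t
          convex {t = t} (_ , dv≤a) ((b<k , b≤mu , _) , _) a≤t t≤b =
            (t<k , ≤-trans t≤b b≤mu , wrapped-OnArc-head wraps dv≤t t<k) , dv≤t
            where
              t<k : t < k
              t<k = ≤-<-trans t≤b b<k
              dv≤t : dv ≤ t
              dv≤t = ≤-trans dv≤a a≤t
          edge : ∀ {t} → Head t → Head (suc t) → EdgeInH t
          edge (_ , dv≤t) ((1+t<k , 1+t≤mu , _) , _) = 1+t≤mu , wrapped-OnArcEdge-head wraps dv≤t (<-trans (n<1+n _) 1+t<k)

      Tail-Conn : ∀ {a b} → Tail a → Tail b → Conn H (P a) (P b)
      Tail-Conn = Conn-within Tail proj₁ convex edge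
        where
          convex : ∀ {a b t} → Tail a → Tail b → a ≤ t → t ≤ b → Tail t
          convex {t = t} _ ((b<k , b≤mu , _) , b≤g) a≤t t≤b =
            (≤-<-trans t≤b b<k , ≤-trans t≤b b≤mu , wrapped-OnArc-tail wraps t≤g) , t≤g
            where
              t≤g : t ≤ g
              t≤g = ≤-trans t≤b b≤g
          edge : ∀ {t} → Tail t → Tail (suc t) → EdgeInH t
          edge _ ((_ , 1+t≤mu , _) , 1+t≤g) = 1+t≤mu , wrapped-OnArcEdge-tail wraps 1+t≤g

      InH-beyond-tail : ∀ {t} → InH t → ¬ t ≤ g → dv ≤ t
      InH-beyond-tail (_ , _ , on) t≰g = Sum.[ (λ dv≤t → dv≤t) , (λ t≤g → ⊥-elim (t≰g t≤g)) ]′ (wrapped-OnArc⇒ wraps on)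

      InH⇒Tail : ¬ dv ≤ mu → ∀ {t} → InH t → Tail t
      InH⇒Tail dv≰mu h with InH⇒Head⊎Tail h
      ... | inj₁ ((_ , t≤mu , _) , dv≤t) = ⊥-elim (dv≰mu (≤-trans dv≤t t≤mu))
      ... | inj₂ tail                    = tail

      SameSide-Conn : ∀ {a b} → SameSide {L = Head} {R = Tail} a b → Conn H (P a) (P b)
      SameSide-Conn (inj₁ (ha , hb)) = Head-Conn ha hb
      SameSide-Conn (inj₂ (ta , tb)) = Tail-Conn ta tb

      -- Within H one cannot step from the tail across g, since the ω(v)-edge there would have
      -- to lie before g or after dv.
      Conn-stays-in-tail : ∀ {a b} → a < k → b < k → Conn H (P a) (P b) → a ≤ g → b ≤ g
      Conn-stays-in-tail {a} {b} a<k b<k c a≤g = from-P (Conn-preserves InTail edge-step c (a , a<k , refl , a≤g))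
        where
          InTail : Fin N → Set
          InTail x = ∃[ t ] (t < k × x ≡ P t × t ≤ g)

          from-P : InTail (P b) → b ≤ g
          from-P (t , t<k , Pb≡Pt , t≤g) = subst (_≤ g) (P-injective t<k b<k (sym Pb≡Pt)) t≤g

          edge-step : ∀ x y → Ed H x y → InTail x → InTail y
          edge-step x y e (t , t<k , refl , t≤g) with H-edge⇒EdgeInH e
          ... | s , s<k , (s<mu , on) , inj₁ (Pt≡Ps , y≡) with P-injective t<k s<k Pt≡Ps | wrapped-OnArcEdge⇒ wraps on
          ...   | refl | inj₁ dv≤s = ⊥-elim (<-irrefl refl (<-≤-trans g<dv (≤-trans dv≤s t≤g)))
          ...   | refl | inj₂ s<g  = suc s , ≤-<-trans s<mu mu<k , y≡ , s<g
          edge-step x y e (t , t<k , refl , t≤g)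
              | s , s<k , (s<mu , _) , inj₂ (y≡ , Pt≡P1+s) with P-injective t<k (≤-<-trans s<mu mu<k) Pt≡P1+s
          ...   | refl = s , s<k , y≡ , ≤-trans (n≤1+n s) t≤g

    atMostTwo : AtMostTwoComponents H
    atMostTwo x y z x∈ y∈ z∈ with H-vertex⇒InH x∈ | H-vertex⇒InH y∈ | H-vertex⇒InH z∈ | shape
    ... | a , refl , ha | b , refl , hb | _ , _ , _ | unwrapped unwr = inj₁ (unwrapped-Conn unwr ha hb)
    ... | a , refl , ha | b , refl , hb | c , refl , hc | wrapped g wraps
      with two-of-three-same-side {a = a} {b} {c} (Wrapped.InH⇒Head⊎Tail wraps ha) (Wrapped.InH⇒Head⊎Tail wraps hb)
                                  (Wrapped.InH⇒Head⊎Tail wraps hc)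
    ... | inj₁ ab        = inj₁ (Wrapped.SameSide-Conn wraps {a} {b} ab)
    ... | inj₂ (inj₁ ac) = inj₂ (inj₁ (Wrapped.SameSide-Conn wraps {a} {c} ac))
    ... | inj₂ (inj₂ bc) = inj₂ (inj₂ (Wrapped.SameSide-Conn wraps {b} {c} bc))

    two-components⇒wrapped : ExactlyTwoComponents H → ∃[ g ] (k + g ≡ dv + mv × dv ≤ mu)
    two-components⇒wrapped (_ , x , y , x∈ , y∈ , ¬c) with H-vertex⇒InH x∈ | H-vertex⇒InH y∈ | shape
    ... | a , refl , ha | b , refl , hb | unwrapped unwr = ⊥-elim (¬c (unwrapped-Conn unwr ha hb))
    ... | a , refl , ha | b , refl , hb | wrapped g wraps with dv ≤? mu
    ...   | yes dv≤mu = g , wraps , dv≤mu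
    ...   | no dv≰mu  = ⊥-elim (¬c (Tail-Conn (InH⇒Tail dv≰mu ha) (InH⇒Tail dv≰mu hb)))
      where open Wrapped wraps

    -- A neighbour of u off ω(u) lies beyond mu ≥ dv, hence on the head of the arc of ω(v).
    wrapped-u-nbrs∈Wv : ∀ {g} → k + g ≡ dv + mv → dv ≤ mu → ∀ z → E G u z → z ∈ verts (cycle Wv)
    wrapped-u-nbrs∈Wv wraps dv≤mu z uz with coordinate (I-nbr∈C u∈I uz) | z ∈? verts (cycle Wu)
    ... | t , t<k , refl | yes z∈u with WedgeArc.anchor-nbrs Au _ uz z∈u
    ...   | inj₁ z≡P0  = subst (_∈ _) (sym z≡P0) (RV.OnArc⇒vertex 0<k (wrapped-OnArc-tail wraps z≤n))
    ...   | inj₂ z≡Pmu = subst (_∈ _) (sym z≡Pmu) (RV.OnArc⇒vertex mu<k (wrapped-OnArc-head wraps dv≤mu mu<k))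
    wrapped-u-nbrs∈Wv wraps dv≤mu z uz | t , t<k , refl | no z∉u with mu <? t
    ...   | yes mu<t = RV.OnArc⇒vertex t<k (wrapped-OnArc-head wraps (≤-trans dv≤mu (<⇒≤ mu<t)) t<k)
    ...   | no mu≮t  = ⊥-elim (z∉u (≤mu⇒vertex-u (≮⇒≥ mu≮t)))

    two-components⇒u-attaches : ExactlyTwoComponents H → Attaches G C u Wv
    two-components⇒u-attaches two with two-components⇒wrapped two
    ... | _ , wraps , dv≤mu = u∈I , (λ u∈v → Wv-vertex≢u u∈v refl) , wrapped-u-nbrs∈Wv wraps dv≤mu

    module UV = ArcComparison u∈I v∈I Wu Au 0 0<k refl Wv Av dv dv<k yv≡Pdv

    -- In the unwrapped shape mutual attachment would force both wedges onto the same arc.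
    attaching⇒two-components : Attaches G C u Wv → Attaches G C v Wu → ExactlyTwoComponents H
    attaching⇒two-components (_ , _ , u-nbrs) (_ , _ , v-nbrs) with shape
    ... | unwrapped unwr = ⊥-elim (UV.attached-arcs-differ u≢v u-nbrs (sym dv≡0 , ≤-antisym mu≤mv mv≤mu))
      where
        on-v : ∀ {t} → t < k → E G u (P t) → dv ≤ t × t ≤ dv + mv
        on-v {t} t<k ut = unwrapped-OnArc⇒ unwr (RV.vertex-OnArc (u-nbrs _ ut) (C-vertex≢I v∈I (P∈C t)) t<k refl)
        dv≡0 : dv ≡ 0
        dv≡0 = n≤0⇒n≡0 (proj₁ (on-v 0<k (WedgeArc.anchor-adj₀ Au)))
        mu≤mv : mu ≤ mv
        mu≤mv = subst (λ d → mu ≤ d + mv) dv≡0 (proj₂ (on-v mu<k (WedgeArc.anchor-adjₘ Au)))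
        mv≤mu : mv ≤ mu
        mv≤mu = ≤-trans (m≤n+m mv dv) (OnArc-u⇒≤mu (RU.vertex-OnArc (v-nbrs _ (WedgeArc.anchor-adjₘ Av))
                  (C-vertex≢I u∈I (next^-∈ cs UC mv (WedgeArc.y∈C Av))) unwr (RV.σ^y≡P mv)))
    ... | wrapped g wraps = atMostTwo , P 0 , P mu , InH⇒H-vertex in-H₀ , InH⇒H-vertex in-Hmu , separated
      where
        open Wrapped wraps
        dv≤mu : dv ≤ mu
        dv≤mu = OnArc-u⇒≤mu (RU.vertex-OnArc (v-nbrs _ (WedgeArc.anchor-adj₀ Av))
                  (C-vertex≢I u∈I (WedgeArc.y∈C Av)) dv<k yv≡Pdv)
        in-H₀ : InH 0
        in-H₀ = 0<k , z≤n , wrapped-OnArc-tail wraps z≤n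
        in-Hmu : InH mu
        in-Hmu = mu<k , ≤-refl , wrapped-OnArc-head wraps dv≤mu mu<k
        separated : ¬ Conn H (P 0) (P mu)
        separated c = <-irrefl refl (<-≤-trans (≤-<-trans (Conn-stays-in-tail 0<k mu<k c z≤n) g<dv) dv≤mu)

    module ThirdAnchor (w : Fin N) (w∈I : InI G C w) (w→Wu : Attaches G C w Wu) (w→Wv : Attaches G C w Wv)
                       {g : ℕ} (wraps : k + g ≡ dv + mv) (dv≤mu : dv ≤ mu) where
      open Wrapped wraps

      Ww : Wedge G C w
      Ww = ω w w∈I

      Aw : WedgeArc Ww
      Aw = wedgeArc Ww

      mw : ℕ
      mw = WedgeArc.m Aw

      private
        w-start : ∃[ t ] (t < k × WedgeArc.y Aw ≡ P t)
        w-start = coordinate (WedgeArc.y∈C Aw)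

      dw : ℕ
      dw = proj₁ w-start

      dw<k : dw < k
      dw<k = proj₁ (proj₂ w-start)

      yw≡Pdw : WedgeArc.y Aw ≡ P dw
      yw≡Pdw = proj₂ (proj₂ w-start)

      module RW = ArcCoordinates Ww Aw dw dw<k yw≡Pdw
      module WU = ArcComparison w∈I u∈I Ww Aw dw dw<k yw≡Pdw Wu Au 0 0<k refl
      module WV = ArcComparison w∈I v∈I Ww Aw dw dw<k yw≡Pdw Wv Av dv dv<k yv≡Pdv

      ew : ℕ
      ew = RW.e

      g<k : g < k
      g<k = <-trans g<dv dv<k

      w≢u : w ≢ u
      w≢u refl = proj₁ (proj₂ w→Wu) (anchorIn Wu)

      w≢v : w ≢ v
      w≢v refl = proj₁ (proj₂ w→Wv) (anchorIn Wv)

      w-nbr∈H : ∀ z → E G w z → V H z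
      w-nbr∈H z wz = proj₂ (proj₂ w→Wu) z wz , proj₂ (proj₂ w→Wv) z wz

      w-adj-Pdw : E G w (P dw)
      w-adj-Pdw = subst (E G w) yw≡Pdw (WedgeArc.anchor-adj₀ Aw)

      w-adj-Pew : E G w (P ew)
      w-adj-Pew = subst (E G w) RW.σ^m≡Pe (WedgeArc.anchor-adjₘ Aw)

      in-H-dw : InH dw
      in-H-dw = H-vertex-P⇒InH dw<k (w-nbr∈H _ w-adj-Pdw)

      in-H-ew : InH ew
      in-H-ew = H-vertex-P⇒InH RW.e<k (w-nbr∈H _ w-adj-Pew)

      w-nbr-on-arc : ∀ {t} → t < k → E G w (P t) → OnArc dw mw t → t ≡ dw ⊎ t ≡ ew
      w-nbr-on-arc t<k wt on with RW.anchor-nbrs-P _ wt (RW.OnArc⇒vertex t<k on)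
      ... | inj₁ Pt≡Pdw = inj₁ (P-injective t<k dw<k Pt≡Pdw)
      ... | inj₂ Pt≡Pew = inj₂ (P-injective t<k RW.e<k Pt≡Pew)

      module UnwrappedW (ew≡ : ew ≡ dw + mw) where
        unwr : dw + mw < k
        unwr = subst (_< k) ew≡ RW.e<k

        on-w⇒≤ew : ∀ {t} → OnArc dw mw t → dw ≤ t × t ≤ ew
        on-w⇒≤ew on = Product.map₂ (λ t≤ → subst (_ ≤_) (sym ew≡) t≤) (unwrapped-OnArc⇒ unwr on)

        edge-w⇒<ew : ∀ {t} → OnArcEdge dw mw t → dw ≤ t × t < ew
        edge-w⇒<ew on = Product.map₂ (λ t< → subst (_ <_) (sym ew≡) t<) (unwrapped-OnArcEdge⇒ unwr on)

        ew≤mu : ew ≤ mu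
        ew≤mu = proj₁ (proj₂ in-H-ew)

        on-w⇒on-u : ∀ t → t < k → OnArc dw mw t → OnArc 0 mu t
        on-w⇒on-u t _ on = inj₁ (z≤n , ≤-trans (proj₂ (on-w⇒≤ew on)) ew≤mu)

        edge-w⇒edge-u : ∀ t → t < k → OnArcEdge dw mw t → OnArcEdge 0 mu t
        edge-w⇒edge-u t _ on = inj₁ (z≤n , <-≤-trans (proj₂ (edge-w⇒<ew on)) ew≤mu)

        improves-u : Improves G C Ww Wu
        improves-u with 0 <? dw | ew <? mu
        ... | yes 0<dw | _ = WU.OnArc-⊂⇒Improves on-w⇒on-u edge-w⇒edge-u 0 0<k (inj₁ (z≤n , z≤n))
                               (λ on → <-irrefl refl (<-≤-trans 0<dw (proj₁ (on-w⇒≤ew on))))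
        ... | no _ | yes ew<mu = WU.OnArc-⊂⇒Improves on-w⇒on-u edge-w⇒edge-u mu mu<k (inj₁ (z≤n , ≤-refl))
                                   (λ on → <-irrefl refl (<-≤-trans ew<mu (proj₂ (on-w⇒≤ew on))))
        ... | no 0≮dw | no ew≮mu = ⊥-elim (WU.attached-arcs-differ w≢u (proj₂ (proj₂ w→Wu)) (dw≡0 , mw≡mu))
          where
            dw≡0 : dw ≡ 0
            dw≡0 = n≤0⇒n≡0 (≮⇒≥ 0≮dw)
            mw≡mu : mw ≡ mu
            mw≡mu = trans (sym (trans ew≡ (cong (_+ mw) dw≡0))) (≤-antisym ew≤mu (≮⇒≥ ew≮mu))

        improves-v : (dw ≤ g → ew ≤ g) → Improves G C Ww Wv
        improves-v tail-closed with dw ≤? g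
        ... | yes dw≤g = WV.OnArc-⊂⇒Improves inside inside-edge dv dv<k (wrapped-OnArc-head wraps ≤-refl dv<k) dv∉w
          where
            ew≤g : ew ≤ g
            ew≤g = tail-closed dw≤g
            inside : ∀ t → t < k → OnArc dw mw t → OnArc dv mv t
            inside t _ on = wrapped-OnArc-tail wraps (≤-trans (proj₂ (on-w⇒≤ew on)) ew≤g)
            inside-edge : ∀ t → t < k → OnArcEdge dw mw t → OnArcEdge dv mv t
            inside-edge t _ on = wrapped-OnArcEdge-tail wraps (<-≤-trans (proj₂ (edge-w⇒<ew on)) ew≤g)
            dv∉w : ¬ OnArc dw mw dv
            dv∉w on = <-irrefl refl (<-≤-trans g<dv (≤-trans (proj₂ (on-w⇒≤ew on)) ew≤g))
        ... | no dw≰g = WV.OnArc-⊂⇒Improves inside inside-edge 0 0<k (wrapped-OnArc-tail wraps z≤n) 0∉w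
          where
            dv≤dw : dv ≤ dw
            dv≤dw = InH-beyond-tail in-H-dw dw≰g
            inside : ∀ t → t < k → OnArc dw mw t → OnArc dv mv t
            inside t t<k on = wrapped-OnArc-head wraps (≤-trans dv≤dw (proj₁ (on-w⇒≤ew on))) t<k
            inside-edge : ∀ t → t < k → OnArcEdge dw mw t → OnArcEdge dv mv t
            inside-edge t t<k on = wrapped-OnArcEdge-head wraps (≤-trans dv≤dw (proj₁ (edge-w⇒<ew on))) t<k
            0∉w : ¬ OnArc dw mw 0
            0∉w on = <-irrefl refl (<-≤-trans (≤-<-trans z≤n g<dv) (≤-trans dv≤dw (proj₁ (on-w⇒≤ew on))))

      module WrappedW (wrapsW : k + ew ≡ dw + mw) where
        ew<dw : ew < dw
        ew<dw = wrapped-end<start wrapsW (WedgeArc.m<k Aw)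

        on-w⇒on-v : dv ≤ dw → ew ≤ g → ∀ t → t < k → OnArc dw mw t → OnArc dv mv t
        on-w⇒on-v dv≤dw ew≤g t t<k on with wrapped-OnArc⇒ wrapsW on
        ... | inj₁ dw≤t = wrapped-OnArc-head wraps (≤-trans dv≤dw dw≤t) t<k
        ... | inj₂ t≤ew = wrapped-OnArc-tail wraps (≤-trans t≤ew ew≤g)

        edge-w⇒edge-v : dv ≤ dw → ew ≤ g → ∀ t → t < k → OnArcEdge dw mw t → OnArcEdge dv mv t
        edge-w⇒edge-v dv≤dw ew≤g t t<k on with wrapped-OnArcEdge⇒ wrapsW on
        ... | inj₁ dw≤t = wrapped-OnArcEdge-head wraps (≤-trans dv≤dw dw≤t) t<k
        ... | inj₂ t<ew = wrapped-OnArcEdge-tail wraps (<-≤-trans t<ew ew≤g)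

        improves-v : dv ≤ dw → ew ≤ g → Improves G C Ww Wv
        improves-v dv≤dw ew≤g with dv <? dw | ew <? g
        ... | yes dv<dw | _ = WV.OnArc-⊂⇒Improves (on-w⇒on-v dv≤dw ew≤g) (edge-w⇒edge-v dv≤dw ew≤g)
                                dv dv<k (wrapped-OnArc-head wraps ≤-refl dv<k) dv∉w
          where
            dv∉w : ¬ OnArc dw mw dv
            dv∉w on with wrapped-OnArc⇒ wrapsW on
            ... | inj₁ dw≤dv = <-irrefl refl (<-≤-trans dv<dw dw≤dv)
            ... | inj₂ dv≤ew = <-irrefl refl (<-≤-trans g<dv (≤-trans dv≤ew ew≤g))
        ... | no _ | yes ew<g = WV.OnArc-⊂⇒Improves (on-w⇒on-v dv≤dw ew≤g) (edge-w⇒edge-v dv≤dw ew≤g)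
                                  g g<k (wrapped-OnArc-tail wraps ≤-refl) g∉w
          where
            g∉w : ¬ OnArc dw mw g
            g∉w on with wrapped-OnArc⇒ wrapsW on
            ... | inj₁ dw≤g = <-irrefl refl (<-≤-trans g<dv (≤-trans dv≤dw dw≤g))
            ... | inj₂ g≤ew = <-irrefl refl (<-≤-trans ew<g g≤ew)
        ... | no dv≮dw | no ew≮g = ⊥-elim (WV.attached-arcs-differ w≢v (proj₂ (proj₂ w→Wv)) (dw≡dv , mw≡mv))
          where
            dw≡dv : dw ≡ dv
            dw≡dv = ≤-antisym (≮⇒≥ dv≮dw) dv≤dw
            mw≡mv : mw ≡ mv
            mw≡mv = +-cancelˡ-≡ dv mw mv (begin
              dv + mw ≡⟨ cong (_+ mw) dw≡dv ⟨
              dw + mw ≡⟨ wrapsW ⟨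
              k + ew  ≡⟨ cong (k +_) (≤-antisym ew≤g (≮⇒≥ ew≮g)) ⟩
              k + g   ≡⟨ wraps ⟩
              dv + mv ∎)
              where open ≡-Reasoning

        -- The two neighbours pin the start of ω(w)'s arc to the head and its end to the tail.
        split-nbrs⇒improves-v : ∀ {tA tB} → tA < k → tB < k → tA ≤ g → dv ≤ tB →
                                E G w (P tA) → E G w (P tB) → Improves G C Ww Wv
        split-nbrs⇒improves-v {tA} {tB} tA<k tB<k tA≤g dv≤tB wA wB with dw ≤? g | ew ≤? g
        ... | no dw≰g | yes ew≤g = improves-v (InH-beyond-tail in-H-dw dw≰g) ew≤g
        ... | yes dw≤g | _ = ⊥-elim (<-irrefl refl (<-≤-trans g<dv (≤-trans dv≤tB tB≤g)))
          where
            tB≤g : tB ≤ g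
            tB≤g = Sum.[ (λ tB≡dw → subst (_≤ g) (sym tB≡dw) dw≤g) ,
                         (λ tB≡ew → subst (_≤ g) (sym tB≡ew) (≤-trans (<⇒≤ ew<dw) dw≤g)) ]′
                     (w-nbr-on-arc tB<k wB (wrapped-OnArc-head wrapsW (≤-trans dw≤g (≤-trans (<⇒≤ g<dv) dv≤tB)) tB<k))
        ... | no dw≰g | no ew≰g = ⊥-elim (<-irrefl refl (<-≤-trans g<dv (≤-trans dv≤tA tA≤g)))
          where
            dv≤ew : dv ≤ ew
            dv≤ew = InH-beyond-tail in-H-ew ew≰g
            dv≤tA : dv ≤ tA
            dv≤tA = Sum.[ (λ tA≡dw → subst (dv ≤_) (sym tA≡dw) (InH-beyond-tail in-H-dw dw≰g)) ,
                          (λ tA≡ew → subst (dv ≤_) (sym tA≡ew) dv≤ew) ]′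
                      (w-nbr-on-arc tA<k wA (wrapped-OnArc-tail wrapsW (≤-trans tA≤g (≤-trans (<⇒≤ g<dv) dv≤ew))))

        ¬improves-u : ¬ Improves G C Ww Wu
        ¬improves-u = WU.OnArcEdge-⊈⇒¬Improves mu mu<k
          (wrapped-OnArcEdge-head wrapsW (proj₁ (proj₂ in-H-dw)) mu<k) (λ on → <-irrefl refl (OnArcEdge-u⇒<mu on))

        ¬improves-v : (ew ≤ g → dw ≤ g) → ¬ Improves G C Ww Wv
        ¬improves-v tail-closed = WV.OnArcEdge-⊈⇒¬Improves g g<k g-on-w g-off-v
          where
            g-on-w : OnArcEdge dw mw g
            g-on-w with dw ≤? g | ew ≤? g
            ... | yes dw≤g | _        = wrapped-OnArcEdge-head wrapsW dw≤g g<k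
            ... | no dw≰g  | yes ew≤g = ⊥-elim (dw≰g (tail-closed ew≤g))
            ... | no _     | no ew≰g  = wrapped-OnArcEdge-tail wrapsW (≰⇒> ew≰g)
            g-off-v : ¬ OnArcEdge dv mv g
            g-off-v on with wrapped-OnArcEdge⇒ wraps on
            ... | inj₁ dv≤g = <-irrefl refl (<-≤-trans g<dv dv≤g)
            ... | inj₂ g<g  = <-irrefl refl g<g

      nbrs-in-both⇒improves : NbrInEachComponent G C w H → Improves G C Ww Wu ⊎ Improves G C Ww Wv
      nbrs-in-both⇒improves (a , b , wa , wb , a∈ , b∈ , ¬c) with RW.e-spec
      ... | inj₁ ew≡ = inj₁ (UnwrappedW.improves-u ew≡)
      ... | inj₂ wrapsW with H-vertex⇒InH a∈ | H-vertex⇒InH b∈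
      ...   | ta , refl , ha | tb , refl , hb with ta ≤? g | tb ≤? g
      ...     | yes ta≤g | yes tb≤g = ⊥-elim (¬c (Tail-Conn {ta} {tb} (ha , ta≤g) (hb , tb≤g)))
      ...     | no ta≰g  | no tb≰g  =
        ⊥-elim (¬c (Head-Conn {ta} {tb} (ha , InH-beyond-tail ha ta≰g) (hb , InH-beyond-tail hb tb≰g)))
      ...     | yes ta≤g | no tb≰g  =
        inj₂ (WrappedW.split-nbrs⇒improves-v wrapsW (proj₁ ha) (proj₁ hb) ta≤g (InH-beyond-tail hb tb≰g) wa wb)
      ...     | no ta≰g  | yes tb≤g =
        inj₂ (WrappedW.split-nbrs⇒improves-v wrapsW (proj₁ hb) (proj₁ ha) tb≤g (InH-beyond-tail ha ta≰g) wb wa)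

      private
        ends-Conn : (∀ a b → E G w a → E G w b → V H a → V H b → Conn H a b) → Conn H (P dw) (P ew)
        ends-Conn all-conn = all-conn _ _ w-adj-Pdw w-adj-Pew (w-nbr∈H _ w-adj-Pdw) (w-nbr∈H _ w-adj-Pew)

      nbrs-in-one⇒improves-both-or-neither : NbrsInOnlyOneComponent G C w H →
        (Improves G C Ww Wu × Improves G C Ww Wv) ⊎ (¬ Improves G C Ww Wu × ¬ Improves G C Ww Wv)
      nbrs-in-one⇒improves-both-or-neither (_ , all-conn) with RW.e-spec
      ... | inj₁ ew≡ = inj₁ (UnwrappedW.improves-u ew≡ ,
                            UnwrappedW.improves-v ew≡ (Conn-stays-in-tail dw<k RW.e<k (ends-Conn all-conn)))
      ... | inj₂ wrapsW = inj₂ (WrappedW.¬improves-u wrapsW ,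
                               WrappedW.¬improves-v wrapsW
                                 (Conn-stays-in-tail RW.e<k dw<k (Conn-sym H-edge-sym (ends-Conn all-conn))))

    third-wedge-improvement : ∀ w (w∈I : InI G C w) → ExactlyTwoComponents H →
      Attaches G C w Wu → Attaches G C w Wv →
      (NbrInEachComponent G C w H → Improves G C (ω w w∈I) Wu ⊎ Improves G C (ω w w∈I) Wv) ×
      (NbrsInOnlyOneComponent G C w H →
         (Improves G C (ω w w∈I) Wu × Improves G C (ω w w∈I) Wv) ⊎
         (¬ Improves G C (ω w w∈I) Wu × ¬ Improves G C (ω w w∈I) Wv))
    third-wedge-improvement w w∈I two w→Wu w→Wv with two-components⇒wrapped two
    ... | _ , wraps , dv≤mu = nbrs-in-both⇒improves , nbrs-in-one⇒improves-both-or-neither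
      where open ThirdAnchor w w∈I w→Wu w→Wv wraps dv≤mu

  -- Proofs of u ∈ I are not unique, so ω may choose two different wedges at u.
  module SameAnchor (ω : WedgeSelection G C) (u : Fin N) (u∈I u∈I′ : InI G C u) where
    Wu Wv : Wedge G C u
    Wu = ω u u∈I
    Wv = ω u u∈I′

    open TwoWedges Wu Wv

    ev : ℕ
    ev = RV.e

    u∈H : V H u
    u∈H = anchorIn Wu , anchorIn Wv

    u-nbr-on-u : ∀ {t} → t < k → E G u (P t) → P t ∈ verts (cycle Wu) → t ≡ 0 ⊎ t ≡ mu
    u-nbr-on-u t<k ut t∈ = Sum.map (P-injective t<k 0<k) (P-injective t<k mu<k) (WedgeArc.anchor-nbrs Au _ ut t∈)

    u-nbr-on-v : ∀ {t} → t < k → E G u (P t) → P t ∈ verts (cycle Wv) → t ≡ dv ⊎ t ≡ ev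
    u-nbr-on-v t<k ut t∈ = Sum.map (P-injective t<k dv<k) (P-injective t<k RV.e<k) (RV.anchor-nbrs-P _ ut t∈)

    u-adj-Pdv : E G u (P dv)
    u-adj-Pdv = subst (E G u) yv≡Pdv (WedgeArc.anchor-adj₀ Av)

    u-adj-Pev : E G u (P ev)
    u-adj-Pev = subst (E G u) RV.σ^m≡Pe (WedgeArc.anchor-adjₘ Av)

    common-end-Conn-u : ∀ {t} → V H (P t) → t ≡ 0 ⊎ t ≡ mu → t ≡ dv ⊎ t ≡ ev → Conn H (P t) u
    common-end-Conn-u {t} t∈H end-u end-v = step t∈H (Sum.swap (edge-u end-u) , Sum.swap (edge-v end-v)) (here u∈H)
      where
        edge-u : t ≡ 0 ⊎ t ≡ mu → CycEdge (verts (cycle Wu)) u (P t)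
        edge-u (inj₁ refl) = WedgeArc.anchor-edge₀ Au
        edge-u (inj₂ refl) = WedgeArc.anchor-edgeₘ Au
        edge-v : t ≡ dv ⊎ t ≡ ev → CycEdge (verts (cycle Wv)) u (P t)
        edge-v (inj₁ refl) = subst (CycEdge _ u) yv≡Pdv (WedgeArc.anchor-edge₀ Av)
        edge-v (inj₂ refl) = subst (CycEdge _ u) RV.σ^m≡Pe (WedgeArc.anchor-edgeₘ Av)

    -- If the arc of ω(v) starts at 0 and does not wrap, both arcs are [0, mu].
    unwrapped-from-0-Conn-u : ev ≡ dv + mv → dv ≡ 0 → ∀ {t} → t ≤ mu → Conn H (P t) u
    unwrapped-from-0-Conn-u ev≡ dv≡0 {t} t≤mu =
      Conn-trans (Conn-sym H-edge-sym (Conn-along P z≤n (λ s _ s≤t → in-H (≤-trans s≤t t≤mu)) edge))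
                 (common-end-Conn-u (in-H z≤n) (inj₁ refl) (inj₁ (sym dv≡0)))
      where
        dv≤ : ∀ s → dv ≤ s
        dv≤ s = subst (_≤ s) (sym dv≡0) z≤n
        ev≡mu : ev ≡ mu
        ev≡mu with mu ≤? ev
        ... | yes mu≤ev with u-nbr-on-v mu<k (WedgeArc.anchor-adjₘ Au)
                               (RV.OnArc⇒vertex mu<k (inj₁ (dv≤ mu , subst (mu ≤_) ev≡ mu≤ev)))
        ...   | inj₁ mu≡dv = ⊥-elim (<-irrefl (sym (trans mu≡dv dv≡0)) (WedgeArc.1≤m Au))
        ...   | inj₂ mu≡ev = sym mu≡ev
        ev≡mu | no mu≰ev with u-nbr-on-u RV.e<k u-adj-Pev (≤mu⇒vertex-u (<⇒≤ (≰⇒> mu≰ev)))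
        ...   | inj₁ ev≡0  = ⊥-elim (<-irrefl (trans (sym ev≡0) (trans ev≡ (cong (_+ mv) dv≡0))) (WedgeArc.1≤m Av))
        ...   | inj₂ ev≡mu = ev≡mu
        mu≤dv+mv : mu ≤ dv + mv
        mu≤dv+mv = ≤-reflexive (trans (sym ev≡mu) ev≡)
        in-H : ∀ {s} → s ≤ mu → V H (P s)
        in-H {s} s≤mu = ≤mu⇒vertex-u s≤mu , RV.OnArc⇒vertex (≤-<-trans s≤mu mu<k) (inj₁ (dv≤ s , ≤-trans s≤mu mu≤dv+mv))
        edge : ∀ s → 0 ≤ s → s < t → Ed H (P s) (P (suc s))
        edge s _ s<t = RU.OnArcEdge⇒edge s<k (inj₁ (z≤n , <-≤-trans s<t t≤mu)) ,
                       RV.OnArcEdge⇒edge s<k (inj₁ (dv≤ s , <-≤-trans s<t (≤-trans t≤mu mu≤dv+mv)))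
          where
            s<k : s < k
            s<k = <-≤-trans s<t (<⇒≤ (≤-<-trans t≤mu mu<k))

    Conn-u-coordinate : ∀ {t} → t < k → t ≤ mu → OnArc dv mv t → Conn H (P t) u
    Conn-u-coordinate {t} t<k t≤mu on with RV.e-spec
    ... | inj₁ ev≡ with proj₁ (unwrapped-OnArc⇒ (subst (_< k) ev≡ RV.e<k) on)
    ...   | dv≤t with u-nbr-on-u dv<k u-adj-Pdv (≤mu⇒vertex-u (≤-trans dv≤t t≤mu))
    ...     | inj₁ dv≡0  = unwrapped-from-0-Conn-u ev≡ dv≡0 t≤mu
    ...     | inj₂ dv≡mu = common-end-Conn-u t∈H (inj₂ t≡mu) (inj₁ (trans t≡mu (sym dv≡mu)))
      where
        t∈H : V H (P t)
        t∈H = ≤mu⇒vertex-u t≤mu , RV.OnArc⇒vertex t<k on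
        t≡mu : t ≡ mu
        t≡mu = ≤-antisym t≤mu (subst (_≤ t) dv≡mu dv≤t)
    Conn-u-coordinate {t} t<k t≤mu on | inj₂ wrapsV with u-nbr-on-v 0<k (WedgeArc.anchor-adj₀ Au)
                                                            (RV.OnArc⇒vertex 0<k (wrapped-OnArc-tail wrapsV z≤n))
    ... | inj₁ 0≡dv = ⊥-elim (n≮0 (subst (ev <_) (sym 0≡dv) (wrapped-end<start wrapsV (WedgeArc.m<k Av))))
    ... | inj₂ 0≡ev with wrapped-OnArc⇒ wrapsV on
    ...   | inj₂ t≤ev = common-end-Conn-u t∈H (inj₁ t≡0) (inj₂ (trans t≡0 0≡ev))
      where
        t∈H : V H (P t)
        t∈H = ≤mu⇒vertex-u t≤mu , RV.OnArc⇒vertex t<k on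
        t≡0 : t ≡ 0
        t≡0 = n≤0⇒n≡0 (subst (t ≤_) (sym 0≡ev) t≤ev)
    ...   | inj₁ dv≤t with u-nbr-on-u dv<k u-adj-Pdv (≤mu⇒vertex-u (≤-trans dv≤t t≤mu))
    ...     | inj₁ dv≡0  = ⊥-elim (n≮0 (subst (ev <_) dv≡0 (wrapped-end<start wrapsV (WedgeArc.m<k Av))))
    ...     | inj₂ dv≡mu = common-end-Conn-u t∈H (inj₂ t≡mu) (inj₁ (trans t≡mu (sym dv≡mu)))
      where
        t∈H : V H (P t)
        t∈H = ≤mu⇒vertex-u t≤mu , RV.OnArc⇒vertex t<k on
        t≡mu : t ≡ mu
        t≡mu = ≤-antisym t≤mu (subst (_≤ t) dv≡mu dv≤t)

    Conn-u : ∀ {x} → V H x → Conn H x u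
    Conn-u {x} (x∈u , x∈v) with x ≟F u
    ... | yes refl = here u∈H
    ... | no x≢u with RU.vertex⇒OnArc x x∈u x≢u
    ...   | t , t<k , refl , on = Conn-u-coordinate t<k (OnArc-u⇒≤mu on) (RV.vertex-OnArc x∈v x≢u t<k refl)

    H-connected : ∀ {x y} → V H x → V H y → Conn H x y
    H-connected x∈ y∈ = Conn-trans (Conn-u x∈) (Conn-sym H-edge-sym (Conn-u y∈))

    atMostTwo : AtMostTwoComponents H
    atMostTwo _ _ _ x∈ y∈ _ = inj₁ (H-connected x∈ y∈)

    ¬two : ¬ ExactlyTwoComponents H
    ¬two (_ , _ , _ , x∈ , y∈ , ¬c) = ¬c (H-connected x∈ y∈)

    ¬attaches : ¬ Attaches G C u Wv
    ¬attaches (_ , u∉Wv , _) = u∉Wv (anchorIn Wv)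

lemma4p3 : (G : Graph) (C : Cycle G) → IsCobweb G C →
    (ω : WedgeSelection G C) →
    ∀ u v w → (iu : InI G C u) (iv : InI G C v) (iw : InI G C w) →
      AtMostTwoComponents (wsub G C (ω u iu) ∩ wsub G C (ω v iv))
      × (ExactlyTwoComponents (wsub G C (ω u iu) ∩ wsub G C (ω v iv))
          ⇔ (Attaches G C u (ω v iv) × Attaches G C v (ω u iu)))
      × (ExactlyTwoComponents (wsub G C (ω u iu) ∩ wsub G C (ω v iv)) →
          Attaches G C w (ω u iu) → Attaches G C w (ω v iv) →
          (NbrInEachComponent G C w (wsub G C (ω u iu) ∩ wsub G C (ω v iv)) →
             Improves G C (ω w iw) (ω u iu) ⊎ Improves G C (ω w iw) (ω v iv))
          × (NbrsInOnlyOneComponent G C w (wsub G C (ω u iu) ∩ wsub G C (ω v iv)) →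
             (Improves G C (ω w iw) (ω u iu) × Improves G C (ω w iw) (ω v iv))
             ⊎ (¬ Improves G C (ω w iw) (ω u iu) × ¬ Improves G C (ω w iw) (ω v iv))))
lemma4p3 G C cob ω u v w iu iv iw with u ≟F v
... | yes refl =
  atMostTwo , mk⇔ (⊥-elim ∘′ ¬two) (⊥-elim ∘′ ¬attaches ∘′ proj₁) , (λ two _ _ → ⊥-elim (¬two two))
  where open Cobweb.SameAnchor G C cob ω u iu iv
... | no u≢v =
  atMostTwo ,
  mk⇔ (λ two → two-components⇒u-attaches two ,
               VU.two-components⇒u-attaches (ExactlyTwoComponents-∩-comm (wsub G C Wu) (wsub G C Wv) two))
      (Product.uncurry attaching⇒two-components) ,
  third-wedge-improvement w iw
  where
    open Cobweb.DistinctAnchors G C cob ω u v iu iv u≢v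
    module VU = Cobweb.DistinctAnchors G C cob ω v u iv iu (u≢v ∘′ sym)
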